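{- Let $n\ge2$ and $N=\frac12 n(n-1)$. (a) Suppose $u_1,\dots,u_N\in\{1,\dots,n-1\}$ are such that $\Phi'=R_{u_N}\circ R_{u_{N-1}}\circ\cdots\circ R_{u_1}$ is a well-defined map from $\mathcal{O}_n$ to $\mathcal{T}_n$, i.e. for every $T\in\mathcal{O}_n$ each successive raising operator is applicable and the final result lies in $\mathcal{T}_n$. Then $\Phi'=\Phi$. (b) Suppose $u_1,\dots,u_N\in\{1,\dots,n-1\}$ are such that $\Psi'=L_{u_N}\circ\cdots\circ L_{u_1}$ is a well-defined map from $\mathcal{T}_n$ to $\mathcal{O}_n$. Then $\Psi'=\Psi$.
   Context: Let $\mathcal{X}=\{x_i,y_i:1\le i\le n\}$ be formal symbols. For $1\le k\le n-1$, let $\mathcal{V}_k=\{a_{ij},b_{ij}:1\le i<j\le n,\ j-i=k\}$ be formal symbols. A triangle of order $n$ is an array with rows $1,\dots,n$, where row $r$ has $r$ entries at positions $1,\dots,r$. Row $n$ is $1,2,\dots,n$, and the entries of rows $1,\dots,n-1$ lie in $\mathcal{X}\cup\bigcup_k\mathcal{V}_k$. There is also a notional empty row $0$. A row $r\in\{1,\dots,n-1\}$ is an $\mathcal{X}$-row if all its entries lie in $\mathcal{X}$, and a $\mathcal{V}$-row if all its entries lie in a single $\mathcal{V}_k$; row $0$ counts as both. An arrangement is a triple $(u,v,w)$ such that, for some $2\le e\le n$ and $1\le p\le e-1$, $u,w$ are at positions $p,p+1$ of row $e$ and $v$ is at position $p$ of row $e-1$. An admissible ranking assigns a nonnegative integer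 rank to rows $0,\dots,n$ such that: - row $n$ has rank $0$ and row $n-1$ has rank $1$; - for $1\le r\le n-1$, if row $r$ has rank $k$ then either row $r$ is an $\mathcal{X}$-row and row $r-1$ has rank $k$, or row $r$ has all entries in $\mathcal{V}_k$ and row $r-1$ has rank $k+1$. It is unique when it exists. In a row of rank $t$, left and right values are: - $l(a_{ij})=l(b_{ij})=i$ and $r(a_{ij})=r(b_{ij})=j$; - $l(x_i)=i$ and $r(x_i)=i+t$; - $l(y_j)=j-t$ and $r(y_j)=j$; - for the integer $i$ in row $n$, $l=r=i$. A triangle is admissible if it has an admissible ranking and every arrangement $(u,v,w)$ satisfies: $l(u)\le l(v)$; $r(v)\le r(w)$; $l(u)<l(v)$ if $u$ is some $y_j$; $r(v)<r(w)$ if $w$ is some $x_j$; and $l(u)<l(w)$. $\mathcal{O}_n$ is the set of oriented complete monotone triangles of order $n$. A complete monotone triangle has rows $1..n$, row $k$ with $k$ strictly increasing integers, row $n=1,\dots,n$, and each entry $j$ at position $p$ of row $k<n$ satisfies $i\le j\le k'$ for the entries $i,k'$ at positions $p,p+1$ of row $k+1$. It is oriented by replacing each such $j$ with $x_j$ (right) or $y_j$ (left), where $x_j$ is forced if $i=j<k'$, $y_j$ is forced if $i<j=k'$, and either is allowed if $i<j<k'$. $\mathcal{T}_n$ is the set of tournaments on $\{1,\dots,n\}$, identified with triangles whose row $r$ ($1\le r\le n-1$) has at position $i$ the symbol $a_{i,i+n-r}$ if the edge is oriented $i\to i+n-r$ and $b_{i,i+n-r}$ if it is oriented $i+n-r\to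 i$. Raising $R_d$ ($1\le d\le n-1$) is applicable to an admissible triangle whose row $d$ is an $\mathcal{X}$-row and row $d-1$ a $\mathcal{V}$-row, both of rank $t$. All other rows are unchanged. 1. Wherever row $d-1$ has $b_{jk}$ at position $p$ and row $d$ has $x_j$ at position $p$, exchange them. Wherever row $d-1$ has $a_{jk}$ at position $p$ and row $d$ has $y_k$ at position $p+1$, move $y_k$ to position $p$ of row $d-1$ and $a_{jk}$ to position $p+1$ of row $d$. 2. Replace each remaining $a_{jk}$ (resp. $b_{jk}$) in row $d-1$ by $x_j$ (resp. $y_k$). Replace each remaining $x_i$ (resp. $y_j$) in row $d$ by $a_{i,i+t}$ (resp. $b_{j-t,j}$). Lowering $L_d$ is applicable when row $d$ is a $\mathcal{V}$-row of rank $t$ and row $d-1$ an $\mathcal{X}$-row. All other rows are unchanged. 1. Wherever row $d-1$ has $x_j$ at position $p$ and row $d$ has $b_{jk}$ at position $p$, exchange them. Wherever row $d-1$ has $y_k$ at position $p$ and row $d$ has $a_{jk}$ at position $p+1$, move $a_{jk}$ to position $p$ of row $d-1$ and $y_k$ to position $p+1$ of row $d$. 2. Replace each remaining $a_{jk}$ (resp. $b_{jk}$) in row $d-1$ by $x_j$ (resp. $y_k$). Replace each remaining $x_j$ (resp. $y_k$) in row $d$ by $a_{j,j+t}$ (resp. $b_{k-t,k}$). $\Phi:\mathcal{O}_n\to\mathcal{T}_n$ is defined as the composite $$\Phi=(R_1\circ R_2\circ\cdots\circ R_{n-1})\circ\cdots\circ(R_1\circ R_2\circ R_3)\circ(R_1\circ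 R_2)\circ(R_1),$$ with the rightmost operator applied first. $\Psi:\mathcal{T}_n\to\mathcal{O}_n$ is defined as $$\Psi=(L_1)\circ(L_2\circ L_1)\circ\cdots\circ(L_{n-1}\circ\cdots\circ L_2\circ L_1).$$ -}

module Defs where

open import Data.Nat using (ℕ; zero; suc; _+_; _*_; _∸_; _≤_; _<_; pred)
open import Agda.Builtin.Nat using (_==_)
open import Data.Nat.DivMod using (_/_)
open import Data.Integer as ℤ using (ℤ; +_)
open import Data.Bool using (Bool; true; false; if_then_else_; _∧_)
open import Data.Maybe using (Maybe; just; nothing; fromMaybe)
open import Data.List using (List; []; _∷_; map; length; upTo; downFrom; concat)
open import Data.List.Relation.Unary.All using (All)
open import Data.Product using (Σ; ∃; _×_)
open import Data.Sum using (_⊎_)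
open import Relation.Binary.PropositionalEquality using (_≡_)

-- Symbols: x_i, y_i (the set X), a_ij, b_ij (the sets V_k), and the
-- integers i of the bottom row n (num i).

data Sym : Set where
  x y : ℕ → Sym
  a b : ℕ → ℕ → Sym
  num : ℕ → Sym

data InX (n : ℕ) : Sym → Set where
  inx : ∀ {i} → 1 ≤ i → i ≤ n → InX n (x i)
  iny : ∀ {i} → 1 ≤ i → i ≤ n → InX n (y i)

data InV (n k : ℕ) : Sym → Set where
  ina : ∀ {i j} → 1 ≤ k → 1 ≤ i → j ≤ n → j ≡ i + k → InV n k (a i j)
  inb : ∀ {i j} → 1 ≤ k → 1 ≤ i → j ≤ n → j ≡ i + k → InV n k (b i j)

IsX : Sym → Set
IsX s = ∃ λ j → s ≡ x j

IsY : Sym → Set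
IsY s = ∃ λ j → s ≡ y j

-- Triangles: a triangle is the list of its rows 1..n (row r = list element
-- number r, 1-based); positions within rows are 1-based as well.

Tri : Set
Tri = List (List Sym)

at : {A : Set} → List A → ℕ → Maybe A
at _        zero          = nothing
at []       (suc _)       = nothing
at (s ∷ ss) (suc zero)    = just s
at (s ∷ ss) (suc (suc p)) = at ss (suc p)

-- total version with a dummy default (only used inside the operators,
-- where positions are in range)
get : List Sym → ℕ → Sym
get l p = fromMaybe (num 0) (at l p)

-- row r of a triangle; row 0 is the notional empty row
row : Tri → ℕ → List Sym
row T r = fromMaybe [] (at T r)

setAt : {A : Set} → ℕ → A → List A → List A
setAt zero          _ l        = l
setAt (suc _)       _ []       = []
setAt (suc zero)    z (_ ∷ l)  = z ∷ l
setAt (suc (suc p)) z (w ∷ l)  = w ∷ setAt (suc p) z l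

positions : ℕ → List ℕ
positions m = map suc (upTo m)

Shape : ℕ → Tri → Set
Shape n T = length T ≡ n
          × (∀ r → 1 ≤ r → r ≤ n → length (row T r) ≡ r)
          × row T n ≡ map num (positions n)

Triangle : ℕ → Tri → Set
Triangle n T = Shape n T
  × (∀ r → 1 ≤ r → r ≤ n ∸ 1 → All (λ s → InX n s ⊎ ∃ λ k → InV n k s) (row T r))

-- X-rows and V-rows (row 0 is empty, hence both)
XRow : ℕ → Tri → ℕ → Set
XRow n T r = All (InX n) (row T r)

VRow : ℕ → Tri → ℕ → Set
VRow n T r = ∃ λ k → All (InV n k) (row T r)

IsRanking : ℕ → Tri → (ℕ → ℕ) → Set
IsRanking n T ρ = ρ n ≡ 0 × ρ (n ∸ 1) ≡ 1
  × (∀ r → 1 ≤ r → r ≤ n ∸ 1 →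
       (XRow n T r × ρ (r ∸ 1) ≡ ρ r)
     ⊎ (All (InV n (ρ r)) (row T r) × ρ (r ∸ 1) ≡ suc (ρ r)))

lval : ℕ → Sym → ℤ
lval t (x i)   = + i
lval t (y j)   = + j ℤ.- + t
lval t (a i j) = + i
lval t (b i j) = + i
lval t (num i) = + i

rval : ℕ → Sym → ℤ
rval t (x i)   = + (i + t)
rval t (y j)   = + j
rval t (a i j) = + j
rval t (b i j) = + j
rval t (num i) = + i

-- conditions on an arrangement (u,v,w); u,w in a row of rank te,
-- v in the row above of rank tv
ArrCond : ℕ → ℕ → Sym → Sym → Sym → Set
ArrCond te tv u v w =
    lval te u ℤ.≤ lval tv v
  × rval tv v ℤ.≤ rval te w
  × (IsY u → lval te u ℤ.< lval tv v)
  × (IsX w → rval tv v ℤ.< rval te w)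
  × lval te u ℤ.< lval te w

ArrOK : ℕ → Tri → (ℕ → ℕ) → Set
ArrOK n T ρ = ∀ e p u v w → 2 ≤ e → e ≤ n → 1 ≤ p → p ≤ e ∸ 1 →
  at (row T e) p ≡ just u → at (row T (e ∸ 1)) p ≡ just v →
  at (row T e) (suc p) ≡ just w → ArrCond (ρ e) (ρ (e ∸ 1)) u v w

AdmissibleWith : ℕ → Tri → (ℕ → ℕ) → Set
AdmissibleWith n T ρ = Triangle n T × IsRanking n T ρ × ArrOK n T ρ

Admissible : ℕ → Tri → Set
Admissible n T = Σ (ℕ → ℕ) (AdmissibleWith n T)

-- U = row d-1 (V-row), D = row d (X-row).
-- Each new entry is computed from the original rows: step 1 (exchanges /
-- moves) takes precedence, otherwise step 2 (conversion) applies.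

raiseU : List Sym → List Sym → ℕ → Sym
raiseU U D p with get U p
... | b j k = case-b (get D p)
  where case-b : Sym → Sym
        case-b (x j') = if j == j' then x j else y k
        case-b _      = y k
... | a j k = case-a (get D (suc p))
  where case-a : Sym → Sym
        case-a (y k') = if k == k' then y k else x j
        case-a _      = x j
... | s = s

raiseD : ℕ → List Sym → List Sym → ℕ → Sym
raiseD t U D q with get D q
... | x j = case-x (get U q)
  where case-x : Sym → Sym
        case-x (b j' k) = if j == j' then b j' k else a j (j + t)
        case-x _        = a j (j + t)
... | y k = case-y (get U (pred q))
  where case-y : Sym → Sym
        case-y (a j k') = if k == k' then a j k' else b (k ∸ t) k
        case-y _        = b (k ∸ t) k
... | s = s

raise : ℕ → ℕ → Tri → Tri
raise t d T =
  setAt (d ∸ 1) (map (raiseU U D) (positions (length U)))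
    (setAt d (map (raiseD t U D) (positions (length D))) T)
  where U = row T (d ∸ 1)
        D = row T d

-- Lowering L_d with rank t.  U = row d-1 (X-row), D = row d (V-row).
lowerU : ℕ → List Sym → List Sym → ℕ → Sym
lowerU t U D p with get U p
... | x j = case-x (get D p)
  where case-x : Sym → Sym
        case-x (b j' k) = if j == j' then b j' k else a j (j + t)
        case-x _        = a j (j + t)
... | y k = case-y (get D (suc p))
  where case-y : Sym → Sym
        case-y (a j k') = if k == k' then a j k' else b (k ∸ t) k
        case-y _        = b (k ∸ t) k
... | s = s

lowerD : List Sym → List Sym → ℕ → Sym
lowerD U D q with get D q
... | b j k = case-b (get U q)
  where case-b : Sym → Sym
        case-b (x j') = if j == j' then x j else y k
        case-b _      = y k
... | a j k = case-a (get U (pred q))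
  where case-a : Sym → Sym
        case-a (y k') = if k == k' then y k else x j
        case-a _      = x j
... | s = s

lower : ℕ → ℕ → Tri → Tri
lower t d T =
  setAt (d ∸ 1) (map (lowerU t U D) (positions (length U)))
    (setAt d (map (lowerD U D) (positions (length D))) T)
  where U = row T (d ∸ 1)
        D = row T d

RStep : ℕ → ℕ → Tri → Tri → Set
RStep n d T T' = 1 ≤ d × d ≤ n ∸ 1 ×
  Σ (ℕ → ℕ) λ ρ → AdmissibleWith n T ρ × XRow n T d × VRow n T (d ∸ 1)
                  × T' ≡ raise (ρ d) d T

LStep : ℕ → ℕ → Tri → Tri → Set
LStep n d T T' = 1 ≤ d × d ≤ n ∸ 1 ×
  Σ (ℕ → ℕ) λ ρ → AdmissibleWith n T ρ × VRow n T d × XRow n T (d ∸ 1)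
                  × T' ≡ lower (ρ d) d T

-- Applying the operators indexed by u₁, u₂, …, u_N in this order
-- (u₁ first), i.e. R_{u_N} ∘ ⋯ ∘ R_{u₁}, each step applicable.
RChain : ℕ → List ℕ → Tri → Tri → Set
RChain n []       T T'' = T ≡ T''
RChain n (d ∷ ds) T T'' = Σ Tri λ T' → RStep n d T T' × RChain n ds T' T''

LChain : ℕ → List ℕ → Tri → Tri → Set
LChain n []       T T'' = T ≡ T''
LChain n (d ∷ ds) T T'' = Σ Tri λ T' → LStep n d T T' × LChain n ds T' T''

-- Φ applies R_1; R_2,R_1; R_3,R_2,R_1; …; R_{n-1},…,R_1 (in this order)
φseq : ℕ → List ℕ
φseq n = concat (map (λ k → map suc (downFrom k)) (positions (n ∸ 1)))

-- Ψ applies L_1,…,L_{n-1}; L_1,…,L_{n-2}; …; L_1 (in this order)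
ψseq : ℕ → List ℕ
ψseq n = concat (map (λ k → positions k) (map suc (downFrom (n ∸ 1))))

val : Sym → ℕ
val (x j)   = j
val (y j)   = j
val (a _ _) = 0
val (b _ _) = 0
val (num i) = i

IsO : ℕ → Tri → Set
IsO n T = Shape n T
  × (∀ k → 1 ≤ k → k ≤ n ∸ 1 → All (λ s → IsX s ⊎ IsY s) (row T k))
  × (∀ k p → 1 ≤ k → k ≤ n ∸ 1 → 1 ≤ p → p < k →
       val (get (row T k) p) < val (get (row T k) (suc p)))
  × (∀ k p → 1 ≤ k → k ≤ n ∸ 1 → 1 ≤ p → p ≤ k →
       let e  = get (row T k) p
           i  = val (get (row T (suc k)) p)
           k' = val (get (row T (suc k)) (suc p))
       in i ≤ val e × val e ≤ k'
          × (i ≡ val e → val e < k' → IsX e)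
          × (i < val e → val e ≡ k' → IsY e))

IsT : ℕ → Tri → Set
IsT n T = Shape n T
  × (∀ r i → 1 ≤ r → r ≤ n ∸ 1 → 1 ≤ i → i ≤ r →
       at (row T r) i ≡ just (a i (i + (n ∸ r)))
     ⊎ at (row T r) i ≡ just (b i (i + (n ∸ r))))

Npairs : ℕ → ℕ
Npairs n = (n * (n ∸ 1)) / 2

-- Raising and lowering steps are deterministic, since the ranking of an admissible triangle is unique,
-- and steps at two different rows commute: applicability forces the two pairs of rows they act on to be
-- disjoint and non-adjacent, and every step preserves admissibility, the heart of the matter being that
-- the exchanged and converted entries still satisfy the arrangement conditions. By this diamond property,
-- two step sequences from the same triangle that both end where no further step applies end at the same
-- triangle. From an oriented monotone triangle (all rows X-rows) the schedule Φ is always applicable and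
-- ends with all rows V-rows, where no raising applies; neither does one apply to a tournament. Hence any
-- well-defined Φ' agrees with Φ. Lowering is symmetric, Ψ ending with all rows X-rows.

module Submission where

open import Defs
open import Agda.Builtin.Nat using (_==_)
open import Data.Bool using (true; false; if_then_else_)
open import Data.Nat using (ℕ; zero; suc; _+_; _∸_; _≤_; _<_; pred; z≤n; s≤s; s≤s⁻¹; _≤?_; _≟_)
open import Data.Nat.Properties hiding (_≟_)
open import Data.Integer as ℤ using (+_; +≤+; +<+)
import Data.Integer.Properties as ℤ
open import Data.Maybe using (just; nothing; fromMaybe)
open import Data.Maybe.Properties using (just-injective)
open import Data.List using (List; []; _∷_; _++_; map; concat; length; upTo; downFrom; applyUpTo)
open import Data.List.Properties using (map-∘; map-upTo; length-map; length-upTo; map-++; concat-++; ++-identityʳ; upTo-∷ʳ)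
open import Data.List.Relation.Unary.All as All using (All; []; _∷_)
open import Data.Product using (Σ; ∃; _×_; _,_; proj₁; proj₂)
open import Data.Sum using (_⊎_; inj₁; inj₂)
open import Data.Unit using (⊤; tt)
open import Data.Empty using (⊥; ⊥-elim)
open import Function using (_∘_)
open import Relation.Nullary using (¬_; yes; no)
open import Relation.Binary.PropositionalEquality

-- Index arithmetic and 1-indexed rows

≤∸1⇒< : ∀ {m n} → 1 ≤ m → m ≤ n ∸ 1 → m < n
≤∸1⇒< {n = zero}  (s≤s _) ()
≤∸1⇒< {n = suc n} _       m≤n = s≤s m≤n

∸1≢ : ∀ {m} → 1 ≤ m → m ∸ 1 ≢ m
∸1≢ {suc m} _ = 1+n≢n ∘ sym

downward-induction : ∀ {N} (P : ℕ → Set) → P N → (∀ r → suc r ≤ N → P (suc r) → P r) → ∀ r → r ≤ N → P r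
downward-induction {N} P P-N step r r≤N = from (N ∸ r) r (m+[n∸m]≡n r≤N)
  where
    from : ∀ m r → r + m ≡ N → P r
    from zero    r r+0≡N = subst P (trans (sym r+0≡N) (+-identityʳ r)) P-N
    from (suc m) r r+m≡N =
      step r (subst (suc r ≤_) r+m≡N (≤-trans (s≤s (m≤m+n r m)) (≤-reflexive (sym (+-suc r m)))))
        (from m (suc r) (trans (sym (+-suc r m)) r+m≡N))

private variable
  A : Set

at-just⇒bounds : (l : List A) {p : ℕ} {s : A} → at l p ≡ just s → 1 ≤ p × p ≤ length l
at-just⇒bounds (_ ∷ _) {suc zero}    _  = s≤s z≤n , s≤s z≤n
at-just⇒bounds (_ ∷ l) {suc (suc p)} eq with at-just⇒bounds l {suc p} eq
... | _ , p≤ = s≤s z≤n , s≤s p≤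

at-within : (l : List A) {p : ℕ} → 1 ≤ p → p ≤ length l → ∃ λ s → at l p ≡ just s
at-within (s ∷ _) {suc zero}    _ _         = s , refl
at-within (_ ∷ l) {suc (suc p)} _ (s≤s p≤) = at-within l (s≤s z≤n) p≤

All-at : {P : A → Set} (l : List A) → All P l → ∀ p {s} → at l p ≡ just s → P s
All-at (_ ∷ _) (Ps ∷ _) (suc zero)    refl = Ps
All-at (_ ∷ l) (_ ∷ Pl) (suc (suc p)) eq   = All-at l Pl (suc p) eq

at⇒All : {P : A → Set} (l : List A) → (∀ p {s} → at l p ≡ just s → P s) → All P l
at⇒All []      _    = []
at⇒All (_ ∷ l) P-at = P-at 1 refl ∷ at⇒All l (λ { (suc p) → P-at (suc (suc p)) })

at≡get : (l : List Sym) {p : ℕ} → 1 ≤ p → p ≤ length l → at l p ≡ just (get l p)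
at≡get l p≥1 p≤ with at-within l p≥1 p≤
... | _ , eq rewrite eq = refl

get≡ : (l : List Sym) {p : ℕ} {s : Sym} → at l p ≡ just s → get l p ≡ s
get≡ l eq rewrite eq = refl

get-bounds : (l : List Sym) {q : ℕ} {s : Sym} → get l q ≡ s → s ≢ num 0 → 1 ≤ q × q ≤ length l
get-bounds l {q} get≡s s≢0 with at l q in at≡
... | just _  = at-just⇒bounds l at≡
... | nothing = ⊥-elim (s≢0 (sym get≡s))

All-get : {P : Sym → Set} (l : List Sym) → All P l → P (num 0) → ∀ q → P (get l q)
All-get {P} l all-P P-default q with at l q in at≡
... | just s  = All-at l all-P q at≡
... | nothing = P-default

at-applyUpTo : (f : ℕ → A) {m p : ℕ} → p < m → at (applyUpTo f m) (suc p) ≡ just (f p)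
at-applyUpTo f {suc m} {zero}  _         = refl
at-applyUpTo f {suc m} {suc p} (s≤s p<m) = at-applyUpTo (f ∘ suc) p<m

map-positions : (h : ℕ → A) (m : ℕ) → map h (positions m) ≡ applyUpTo (h ∘ suc) m
map-positions h m = trans (sym (map-∘ (upTo m))) (map-upTo (h ∘ suc) m)

at-map-positions : (h : ℕ → A) {m p : ℕ} → 1 ≤ p → p ≤ m → at (map h (positions m)) p ≡ just (h p)
at-map-positions h {m} {suc p} _ p≤m =
  trans (cong (λ l → at l (suc p)) (map-positions h m)) (at-applyUpTo (h ∘ suc) p≤m)

length-map-positions : (h : ℕ → A) (m : ℕ) → length (map h (positions m)) ≡ m
length-map-positions h m = trans (length-map h (positions m)) (trans (length-map suc (upTo m)) (length-upTo m))

at-map-positions⇒ : (h : ℕ → A) {m q : ℕ} {s : A} → at (map h (positions m)) q ≡ just s → (1 ≤ q × q ≤ m) × h q ≡ s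
at-map-positions⇒ h {m} {q} at≡s with at-just⇒bounds (map h (positions m)) at≡s
... | 1≤q , q≤len = (1≤q , q≤m) , just-injective (trans (sym (at-map-positions h 1≤q q≤m)) at≡s)
  where q≤m = subst (q ≤_) (length-map-positions h m) q≤len

All-map-positions : {P : A → Set} (h : ℕ → A) (m : ℕ) → (∀ q → 1 ≤ q → q ≤ m → P (h q)) → All P (map h (positions m))
All-map-positions {P = P} h m P-h = at⇒All (map h (positions m)) P-at
  where
    P-at : ∀ q {s} → at (map h (positions m)) q ≡ just s → P s
    P-at q at≡s with at-map-positions⇒ h {m} {q} at≡s
    ... | (1≤q , q≤m) , refl = P-h q 1≤q q≤m

length-setAt : (i : ℕ) (z : A) (l : List A) → length (setAt i z l) ≡ length l
length-setAt zero          _ _       = refl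
length-setAt (suc _)       _ []      = refl
length-setAt (suc zero)    _ (_ ∷ _) = refl
length-setAt (suc (suc i)) z (_ ∷ l) = cong suc (length-setAt (suc i) z l)

at-setAt-≡ : (i : ℕ) (z : A) (l : List A) → 1 ≤ i → i ≤ length l → at (setAt i z l) i ≡ just z
at-setAt-≡ (suc zero)    _ (_ ∷ _) _ _         = refl
at-setAt-≡ (suc (suc i)) z (_ ∷ l) _ (s≤s i≤) = at-setAt-≡ (suc i) z l (s≤s z≤n) i≤

at-setAt-≢ : (i j : ℕ) (z : A) (l : List A) → i ≢ j → at (setAt i z l) j ≡ at l j
at-setAt-≢ zero          _             _ _       _   = refl
at-setAt-≢ (suc i)       _             _ []      _   = refl
at-setAt-≢ (suc _)       zero          _ (_ ∷ _) _   = refl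
at-setAt-≢ (suc zero)    (suc zero)    _ (_ ∷ _) i≢j = ⊥-elim (i≢j refl)
at-setAt-≢ (suc zero)    (suc (suc j)) _ (_ ∷ _) _   = refl
at-setAt-≢ (suc (suc i)) (suc zero)    _ (_ ∷ _) _   = refl
at-setAt-≢ (suc (suc i)) (suc (suc j)) z (_ ∷ l) i≢j = at-setAt-≢ (suc i) (suc j) z l (i≢j ∘ cong suc)

setAt-comm : (i j : ℕ) (z w : A) (l : List A) → i ≢ j → setAt i z (setAt j w l) ≡ setAt j w (setAt i z l)
setAt-comm zero          _             _ _ _       _   = refl
setAt-comm (suc _)       zero          _ _ _       _   = refl
setAt-comm (suc _)       (suc _)       _ _ []      _   = refl
setAt-comm (suc zero)    (suc zero)    _ _ (_ ∷ _) i≢j = ⊥-elim (i≢j refl)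
setAt-comm (suc zero)    (suc (suc _)) _ _ (_ ∷ _) _   = refl
setAt-comm (suc (suc _)) (suc zero)    _ _ (_ ∷ _) _   = refl
setAt-comm (suc (suc i)) (suc (suc j)) z w (v ∷ l) i≢j =
  cong (v ∷_) (setAt-comm (suc i) (suc j) z w l (i≢j ∘ cong suc))

replaceRows : ℕ → List Sym → List Sym → Tri → Tri
replaceRows e U D T = setAt e U (setAt (suc e) D T)

length-replaceRows : ∀ e U D T → length (replaceRows e U D T) ≡ length T
length-replaceRows e U D T = trans (length-setAt e U _) (length-setAt (suc e) D T)

row-replaceRows-other : ∀ e U D T {r} → r ≢ e → r ≢ suc e → row (replaceRows e U D T) r ≡ row T r
row-replaceRows-other e U D T {r} r≢e r≢1+e =
  cong (fromMaybe []) (trans (at-setAt-≢ e r U _ (r≢e ∘ sym)) (at-setAt-≢ (suc e) r D T (r≢1+e ∘ sym)))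

row-replaceRows-lower : ∀ e U D T → suc e ≤ length T → row (replaceRows e U D T) (suc e) ≡ D
row-replaceRows-lower e U D T e<len =
  cong (fromMaybe []) (trans (at-setAt-≢ e (suc e) U _ (λ ()) ) (at-setAt-≡ (suc e) D T (s≤s z≤n) e<len))

row-replaceRows-upper : ∀ e U D T → e ≤ length T → length U ≡ e → row (replaceRows e U D T) e ≡ U
row-replaceRows-upper zero    [] D T _   _     = refl
row-replaceRows-upper (suc e) U  D T e≤len _ =
  cong (fromMaybe [])
    (at-setAt-≡ (suc e) U (setAt (suc (suc e)) D T) (s≤s z≤n) (subst (suc e ≤_) (sym (length-setAt (suc (suc e)) D T)) e≤len))

replaceRows-comm : ∀ e f U D U' D' T → e ≢ f → e ≢ suc f → f ≢ suc e →
  replaceRows e U D (replaceRows f U' D' T) ≡ replaceRows f U' D' (replaceRows e U D T)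
replaceRows-comm e f U D U' D' T e≢f e≢1+f f≢1+e =
  begin
    setAt e U (setAt (suc e) D (setAt f U' (setAt (suc f) D' T)))
  ≡⟨ cong (setAt e U) (setAt-comm (suc e) f D U' _ (f≢1+e ∘ sym)) ⟩
    setAt e U (setAt f U' (setAt (suc e) D (setAt (suc f) D' T)))
  ≡⟨ cong (λ l → setAt e U (setAt f U' l)) (setAt-comm (suc e) (suc f) D D' T (e≢f ∘ suc-injective)) ⟩
    setAt e U (setAt f U' (setAt (suc f) D' (setAt (suc e) D T)))
  ≡⟨ setAt-comm e f U U' _ e≢f ⟩
    setAt f U' (setAt e U (setAt (suc f) D' (setAt (suc e) D T)))
  ≡⟨ cong (setAt f U') (setAt-comm e (suc f) U D' _ e≢1+f) ⟩
    setAt f U' (setAt (suc f) D' (setAt e U (setAt (suc e) D T)))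
  ∎
  where open ≡-Reasoning

RowsUpdate : Set
RowsUpdate = List Sym → List Sym → List Sym

updateRows : RowsUpdate → RowsUpdate → ℕ → Tri → Tri
updateRows F G e T = replaceRows e (F (row T e) (row T (suc e))) (G (row T e) (row T (suc e))) T

updateRows-comm : ∀ F G F' G' e f T → e ≢ f → e ≢ suc f → f ≢ suc e →
  updateRows F G e (updateRows F' G' f T) ≡ updateRows F' G' f (updateRows F G e T)
updateRows-comm F G F' G' e f T e≢f e≢1+f f≢1+e =
  begin
    updateRows F G e (updateRows F' G' f T)
  ≡⟨ cong₂ (λ U D → replaceRows e (F U D) (G U D) (updateRows F' G' f T))
       (row-replaceRows-other f _ _ T e≢f e≢1+f) (row-replaceRows-other f _ _ T (f≢1+e ∘ sym) (e≢f ∘ suc-injective)) ⟩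
    replaceRows e _ _ (replaceRows f _ _ T)
  ≡⟨ replaceRows-comm e f _ _ _ _ T e≢f e≢1+f f≢1+e ⟩
    replaceRows f _ _ (replaceRows e _ _ T)
  ≡⟨ sym (cong₂ (λ U D → replaceRows f (F' U D) (G' U D) (updateRows F G e T))
       (row-replaceRows-other e _ _ T (e≢f ∘ sym) f≢1+e) (row-replaceRows-other e _ _ T (e≢1+f ∘ sym) (e≢f ∘ sym ∘ suc-injective))) ⟩
    updateRows F' G' f (updateRows F G e T)
  ∎
  where open ≡-Reasoning

-- Left and right values, and the entrywise rules of raising and lowering

-- ℕ-valued lval and rval: left truncates j ∸ t, so the two agree only under LeftNatural.
left : ℕ → Sym → ℕ
left t (x i)   = i
left t (y j)   = j ∸ t
left t (a i j) = i
left t (b i j) = i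
left t (num i) = i

right : ℕ → Sym → ℕ
right t (x i)   = i + t
right t (y j)   = j
right t (a i j) = j
right t (b i j) = j
right t (num i) = i

LeftNatural : ℕ → Sym → Set
LeftNatural t (y j) = t ≤ j
LeftNatural t _     = ⊤

lval≡left : ∀ t s → LeftNatural t s → lval t s ≡ + left t s
lval≡left t (x i)   _   = refl
lval≡left t (y j)   t≤j = trans (ℤ.m-n≡m⊖n j t) (ℤ.⊖-≥ t≤j)
lval≡left t (a i j) _   = refl
lval≡left t (b i j) _   = refl
lval≡left t (num i) _   = refl

rval≡right : ∀ t s → rval t s ≡ + right t s
rval≡right t (x i)   = refl
rval≡right t (y j)   = refl
rval≡right t (a i j) = refl
rval≡right t (b i j) = refl
rval≡right t (num i) = refl

ArrCondℕ : ℕ → ℕ → Sym → Sym → Sym → Set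
ArrCondℕ te tv u v w =
    left te u ≤ left tv v
  × right tv v ≤ right te w
  × (IsY u → left te u < left tv v)
  × (IsX w → right tv v < right te w)
  × left te u < left te w

module _ {te tv u v w} (u-nat : LeftNatural te u) (v-nat : LeftNatural tv v) (w-nat : LeftNatural te w) where
  private
    lu = lval≡left te u u-nat
    lv = lval≡left tv v v-nat
    lw = lval≡left te w w-nat
    rv = rval≡right tv v
    rw = rval≡right te w

  ArrCond⇒ArrCondℕ : ArrCond te tv u v w → ArrCondℕ te tv u v w
  ArrCond⇒ArrCondℕ (c₁ , c₂ , c₃ , c₄ , c₅) =
    ℤ.drop‿+≤+ (subst₂ ℤ._≤_ lu lv c₁) ,
    ℤ.drop‿+≤+ (subst₂ ℤ._≤_ rv rw c₂) ,
    (λ u-y → ℤ.drop‿+<+ (subst₂ ℤ._<_ lu lv (c₃ u-y))) ,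
    (λ w-x → ℤ.drop‿+<+ (subst₂ ℤ._<_ rv rw (c₄ w-x))) ,
    ℤ.drop‿+<+ (subst₂ ℤ._<_ lu lw c₅)

  ArrCondℕ⇒ArrCond : ArrCondℕ te tv u v w → ArrCond te tv u v w
  ArrCondℕ⇒ArrCond (c₁ , c₂ , c₃ , c₄ , c₅) =
    subst₂ ℤ._≤_ (sym lu) (sym lv) (+≤+ c₁) ,
    subst₂ ℤ._≤_ (sym rv) (sym rw) (+≤+ c₂) ,
    (λ u-y → subst₂ ℤ._<_ (sym lu) (sym lv) (+<+ (c₃ u-y))) ,
    (λ w-x → subst₂ ℤ._<_ (sym rv) (sym rw) (+<+ (c₄ w-x))) ,
    subst₂ ℤ._<_ (sym lu) (sym lw) (+<+ c₅)

ArrCond-sameMiddle : ∀ {te tv u v v' w} → LeftNatural tv v → LeftNatural tv v' →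
  left tv v ≡ left tv v' → right tv v ≡ right tv v' → ArrCond te tv u v w → ArrCond te tv u v' w
ArrCond-sameMiddle {te} {tv} {u} {v} {v'} {w} v-nat v'-nat left≡ right≡ (c₁ , c₂ , c₃ , c₄ , c₅) =
  subst (lval te u ℤ.≤_) lval≡ c₁ , subst (ℤ._≤ rval te w) rval≡ c₂ ,
  (λ u-y → subst (lval te u ℤ.<_) lval≡ (c₃ u-y)) , (λ w-x → subst (ℤ._< rval te w) rval≡ (c₄ w-x)) , c₅
  where
    lval≡ = trans (lval≡left tv v v-nat) (trans (cong +_ left≡) (sym (lval≡left tv v' v'-nat)))
    rval≡ = trans (rval≡right tv v) (trans (cong +_ right≡) (sym (rval≡right tv v')))

==-refl : ∀ m → (m == m) ≡ true
==-refl zero    = refl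
==-refl (suc m) = ==-refl m

==-≢ : ∀ {m n} → m ≢ n → (m == n) ≡ false
==-≢ {zero}  {zero}  m≢n = ⊥-elim (m≢n refl)
==-≢ {zero}  {suc n} _   = refl
==-≢ {suc m} {zero}  _   = refl
==-≢ {suc m} {suc n} m≢n = ==-≢ (m≢n ∘ cong suc)

-- Raising and lowering rewrite each entry by one of two local rules, given the entries it may be
-- exchanged with: toV turns an X-symbol into a V-symbol, toX a V-symbol into an X-symbol.
vFromX : ℕ → ℕ → Sym → Sym
vFromX t j (b j' k) = if j == j' then b j' k else a j (j + t)
vFromX t j (x _)    = a j (j + t)
vFromX t j (y _)    = a j (j + t)
vFromX t j (a _ _)  = a j (j + t)
vFromX t j (num _)  = a j (j + t)

vFromY : ℕ → ℕ → Sym → Sym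
vFromY t k (a j k') = if k == k' then a j k' else b (k ∸ t) k
vFromY t k (x _)    = b (k ∸ t) k
vFromY t k (y _)    = b (k ∸ t) k
vFromY t k (b _ _)  = b (k ∸ t) k
vFromY t k (num _)  = b (k ∸ t) k

xFromB : ℕ → ℕ → Sym → Sym
xFromB j k (x j')   = if j == j' then x j else y k
xFromB j k (y _)    = y k
xFromB j k (a _ _)  = y k
xFromB j k (b _ _)  = y k
xFromB j k (num _)  = y k

xFromA : ℕ → ℕ → Sym → Sym
xFromA j k (y k')   = if k == k' then y k else x j
xFromA j k (x _)    = x j
xFromA j k (a _ _)  = x j
xFromA j k (b _ _)  = x j
xFromA j k (num _)  = x j

toV : ℕ → Sym → Sym → Sym → Sym
toV t (x j)   u _  = vFromX t j u
toV t (y k)   _ u' = vFromY t k u'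
toV t (a i j) _ _  = a i j
toV t (b i j) _ _  = b i j
toV t (num i) _ _  = num i

toX : Sym → Sym → Sym → Sym
toX (b j k) d _  = xFromB j k d
toX (a j k) _ d' = xFromA j k d'
toX (x i)   _ _  = x i
toX (y i)   _ _  = y i
toX (num i) _ _  = num i

raiseD≡toV : ∀ t U D q → raiseD t U D q ≡ toV t (get D q) (get U q) (get U (pred q))
raiseD≡toV t U D q with get D q
... | x j with get U q
...   | b _ _ = refl
...   | x _   = refl
...   | y _   = refl
...   | a _ _ = refl
...   | num _ = refl
raiseD≡toV t U D q | y k with get U (pred q)
...   | a _ _ = refl
...   | x _   = refl
...   | y _   = refl
...   | b _ _ = refl
...   | num _ = refl
raiseD≡toV t U D q | a _ _ = refl
raiseD≡toV t U D q | b _ _ = refl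
raiseD≡toV t U D q | num _ = refl

lowerU≡toV : ∀ t U D p → lowerU t U D p ≡ toV t (get U p) (get D p) (get D (suc p))
lowerU≡toV t U D p with get U p
... | x j with get D p
...   | b _ _ = refl
...   | x _   = refl
...   | y _   = refl
...   | a _ _ = refl
...   | num _ = refl
lowerU≡toV t U D p | y k with get D (suc p)
...   | a _ _ = refl
...   | x _   = refl
...   | y _   = refl
...   | b _ _ = refl
...   | num _ = refl
lowerU≡toV t U D p | a _ _ = refl
lowerU≡toV t U D p | b _ _ = refl
lowerU≡toV t U D p | num _ = refl

raiseU≡toX : ∀ U D p → raiseU U D p ≡ toX (get U p) (get D p) (get D (suc p))
raiseU≡toX U D p with get U p
... | b j k with get D p
...   | x _   = refl
...   | y _   = refl
...   | a _ _ = refl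
...   | b _ _ = refl
...   | num _ = refl
raiseU≡toX U D p | a j k with get D (suc p)
...   | y _   = refl
...   | x _   = refl
...   | a _ _ = refl
...   | b _ _ = refl
...   | num _ = refl
raiseU≡toX U D p | x _   = refl
raiseU≡toX U D p | y _   = refl
raiseU≡toX U D p | num _ = refl

lowerD≡toX : ∀ U D q → lowerD U D q ≡ toX (get D q) (get U q) (get U (pred q))
lowerD≡toX U D q with get D q
... | b j k with get U q
...   | x _   = refl
...   | y _   = refl
...   | a _ _ = refl
...   | b _ _ = refl
...   | num _ = refl
lowerD≡toX U D q | a j k with get U (pred q)
...   | y _   = refl
...   | x _   = refl
...   | a _ _ = refl
...   | b _ _ = refl
...   | num _ = refl
lowerD≡toX U D q | x _   = refl
lowerD≡toX U D q | y _   = refl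
lowerD≡toX U D q | num _ = refl
data XEntry (t : ℕ) : Sym → Set where
  xE : ∀ i → XEntry t (x i)
  yE : ∀ L → XEntry t (y (L + t))

data VEntry (t : ℕ) : Sym → Set where
  aE : ∀ j → VEntry t (a (suc j) (suc j + t))
  bE : ∀ j → VEntry t (b (suc j) (suc j + t))

predLeft : ∀ {t s} → VEntry t s → ℕ
predLeft (aE j) = j
predLeft (bE j) = j

left-VEntry : ∀ {t s} (s-v : VEntry t s) → left t s ≡ suc (predLeft s-v)
left-VEntry (aE j) = refl
left-VEntry (bE j) = refl

right-VEntry : ∀ {t s} (s-v : VEntry t s) → right t s ≡ suc (predLeft s-v) + t
right-VEntry (aE j) = refl
right-VEntry (bE j) = refl

left-y : ∀ L t → left t (y (L + t)) ≡ L
left-y L t = m+n∸n≡m L t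

left-y-suc : ∀ j t → left (suc t) (y (suc j + t)) ≡ j
left-y-suc j t = m+n∸n≡m j t

x≢y : ∀ {i k} → x i ≢ y k
x≢y ()

Spans : ℕ → Sym → Set
Spans t (a i j) = j ≡ i + t
Spans t (b i j) = j ≡ i + t
Spans t _       = ⊤

VEntry⇒Spans : ∀ {t s} → VEntry t s → Spans t s
VEntry⇒Spans (aE j) = refl
VEntry⇒Spans (bE j) = refl

IsAB : Sym → Set
IsAB s = ∃ λ i → ∃ λ j → s ≡ a i j ⊎ s ≡ b i j

IsAB⇒¬IsY : ∀ {s} → IsAB s → ¬ IsY s
IsAB⇒¬IsY (_ , _ , inj₁ refl) (_ , ())
IsAB⇒¬IsY (_ , _ , inj₂ refl) (_ , ())

IsAB⇒¬IsX : ∀ {s} → IsAB s → ¬ IsX s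
IsAB⇒¬IsX (_ , _ , inj₁ refl) (_ , ())
IsAB⇒¬IsX (_ , _ , inj₂ refl) (_ , ())

IsAB⇒InV : ∀ {n t s} → IsAB s → 1 ≤ t → 1 ≤ left t s → right t s ≤ n → right t s ≡ left t s + t → InV n t s
IsAB⇒InV (_ , _ , inj₁ refl) = ina
IsAB⇒InV (_ , _ , inj₂ refl) = inb

vFromX-values : ∀ t i u u' → Spans t u →
  left t (toV t (x i) u u') ≡ i × right t (toV t (x i) u u') ≡ i + t × IsAB (toV t (x i) u u')
vFromX-values t i (b j k) _ k≡j+t with i ≟ j
... | yes refl rewrite ==-refl i = refl , k≡j+t , i , k , inj₂ refl
... | no i≢j   rewrite ==-≢ i≢j  = refl , refl , i , i + t , inj₁ refl
vFromX-values t i (x _)   _ _ = refl , refl , i , i + t , inj₁ refl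
vFromX-values t i (y _)   _ _ = refl , refl , i , i + t , inj₁ refl
vFromX-values t i (a _ _) _ _ = refl , refl , i , i + t , inj₁ refl
vFromX-values t i (num _) _ _ = refl , refl , i , i + t , inj₁ refl

vFromY-values : ∀ t k u u' → Spans t u' →
  left t (toV t (y k) u u') ≡ k ∸ t × right t (toV t (y k) u u') ≡ k × IsAB (toV t (y k) u u')
vFromY-values t k _ (a j k') k'≡j+t with k ≟ k'
... | yes refl rewrite ==-refl k = sym (trans (cong (_∸ t) k'≡j+t) (m+n∸n≡m j t)) , refl , j , k , inj₁ refl
... | no k≢k'  rewrite ==-≢ k≢k' = refl , refl , k ∸ t , k , inj₂ refl
vFromY-values t k _ (x _)   _ = refl , refl , k ∸ t , k , inj₂ refl
vFromY-values t k _ (y _)   _ = refl , refl , k ∸ t , k , inj₂ refl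
vFromY-values t k _ (b _ _) _ = refl , refl , k ∸ t , k , inj₂ refl
vFromY-values t k _ (num _) _ = refl , refl , k ∸ t , k , inj₂ refl

toV-values : ∀ t s u u' → XEntry t s → Spans t u → Spans t u' →
  left t (toV t s u u') ≡ left t s × right t (toV t s u u') ≡ right t s × IsAB (toV t s u u')
toV-values t _ u u' (xE i) u-spans _        = vFromX-values t i u u' u-spans
toV-values t _ u u' (yE L) _       u'-spans = vFromY-values t (L + t) u u' u'-spans

Endpoint : ℕ → ℕ → Sym → Set
Endpoint t J s = s ≡ x J ⊎ s ≡ y (J + t)

xFromA-endpoint : ∀ J K d → xFromA J K d ≡ x J ⊎ xFromA J K d ≡ y K
xFromA-endpoint J K (y k) with K ≟ k
... | yes refl rewrite ==-refl K = inj₂ refl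
... | no K≢k   rewrite ==-≢ K≢k  = inj₁ refl
xFromA-endpoint J K (x _)   = inj₁ refl
xFromA-endpoint J K (a _ _) = inj₁ refl
xFromA-endpoint J K (b _ _) = inj₁ refl
xFromA-endpoint J K (num _) = inj₁ refl

xFromB-endpoint : ∀ J K d → xFromB J K d ≡ x J ⊎ xFromB J K d ≡ y K
xFromB-endpoint J K (x j) with J ≟ j
... | yes refl rewrite ==-refl J = inj₁ refl
... | no J≢j   rewrite ==-≢ J≢j  = inj₂ refl
xFromB-endpoint J K (y _)   = inj₂ refl
xFromB-endpoint J K (a _ _) = inj₂ refl
xFromB-endpoint J K (b _ _) = inj₂ refl
xFromB-endpoint J K (num _) = inj₂ refl

xFromA≡y : ∀ J K d k → xFromA J K d ≡ y k → d ≡ y K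
xFromA≡y J K (y k') _ eq with K ≟ k'
... | yes refl = refl
... | no K≢k'  rewrite ==-≢ K≢k' = ⊥-elim (x≢y eq)

xFromB≡x : ∀ J K d i → xFromB J K d ≡ x i → d ≡ x J
xFromB≡x J K (x j') _ eq with J ≟ j'
... | yes refl = refl
... | no J≢j'  rewrite ==-≢ J≢j' = ⊥-elim (x≢y (sym eq))

xFromB-x≡y⇒≢ : ∀ J K i k → xFromB J K (x i) ≡ y k → J ≢ i
xFromB-x≡y⇒≢ J K i k eq refl rewrite ==-refl J = x≢y eq

xFromA-y≡x⇒≢ : ∀ J K k i → xFromA J K (y k) ≡ x i → K ≢ k
xFromA-y≡x⇒≢ J K k i eq refl rewrite ==-refl K = x≢y (sym eq)

toX-endpoint : ∀ t s d d' (s-v : VEntry t s) → Endpoint t (suc (predLeft s-v)) (toX s d d')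
toX-endpoint t _ d d' (aE j) = xFromA-endpoint (suc j) (suc j + t) d'
toX-endpoint t _ d d' (bE j) = xFromB-endpoint (suc j) (suc j + t) d

toX-values : ∀ t s d d' (s-v : VEntry t s) →
  Endpoint t (suc (predLeft s-v)) (toX s d d') × left t (toX s d d') ≡ left t s × right t (toX s d d') ≡ right t s
toX-values t s d d' s-v with toX-endpoint t s d d' s-v
... | inj₁ eq rewrite eq = inj₁ refl , sym (left-VEntry s-v) , sym (right-VEntry s-v)
... | inj₂ eq rewrite eq = inj₂ refl , trans (left-y (suc (predLeft s-v)) t) (sym (left-VEntry s-v)) , sym (right-VEntry s-v)

module _ {t j : ℕ} where
  endpoint-left≤ : ∀ {s} → Endpoint t (suc j) s → left (suc t) s ≤ suc j
  endpoint-left≤ (inj₁ refl) = ≤-refl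
  endpoint-left≤ (inj₂ refl) rewrite left-y-suc j t = n≤1+n j

  endpoint-left≥ : ∀ {s} → Endpoint t (suc j) s → j ≤ left (suc t) s
  endpoint-left≥ (inj₁ refl) = n≤1+n j
  endpoint-left≥ (inj₂ refl) rewrite left-y-suc j t = ≤-refl

  endpoint-left< : ∀ {s} → Endpoint t (suc j) s → IsY s → left (suc t) s < suc j
  endpoint-left< (inj₁ refl) (_ , ())
  endpoint-left< (inj₂ refl) _ rewrite left-y-suc j t = ≤-refl

  endpoint-right≥ : ∀ {s} → Endpoint t (suc j) s → suc j + t ≤ right (suc t) s
  endpoint-right≥ (inj₁ refl) = +-monoʳ-≤ (suc j) (n≤1+n t)
  endpoint-right≥ (inj₂ refl) = ≤-refl

  endpoint-right> : ∀ {s} → Endpoint t (suc j) s → IsX s → suc j + t < right (suc t) s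
  endpoint-right> (inj₁ refl) _ = ≤-reflexive (sym (+-suc (suc j) t))
  endpoint-right> (inj₂ refl) (_ , ())

Endpoint-InX : ∀ {n t s v} (s-v : VEntry t s) → right t s ≤ n → Endpoint t (suc (predLeft s-v)) v → InX n v
Endpoint-InX {t = t} s-v right≤n (inj₁ refl) = inx (s≤s z≤n) (≤-trans (m≤m+n _ t) (subst (_≤ _) (right-VEntry s-v) right≤n))
Endpoint-InX         s-v right≤n (inj₂ refl) = iny (s≤s z≤n) (subst (_≤ _) (right-VEntry s-v) right≤n)

Endpoint-LeftNatural : ∀ {t J v} → Endpoint t (suc J) v → LeftNatural (suc t) v
Endpoint-LeftNatural         (inj₁ refl) = tt
Endpoint-LeftNatural {t} {J} (inj₂ refl) = +-monoˡ-≤ t (s≤s (z≤n {J}))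

LeftNatural-weaken : ∀ {t} s → LeftNatural (suc t) s → LeftNatural t s
LeftNatural-weaken (x _)   _   = tt
LeftNatural-weaken (y _)   t<j = ≤-trans (n≤1+n _) t<j
LeftNatural-weaken (a _ _) _   = tt
LeftNatural-weaken (b _ _) _   = tt
LeftNatural-weaken (num _) _   = tt

raised-middle-bounds : ∀ t Dp Dp1 Up → XEntry t Dp → XEntry t Dp1 → VEntry t Up → ArrCondℕ t t Dp Up Dp1 →
  left t Dp ≤ left (suc t) (toX Up Dp Dp1) × right (suc t) (toX Up Dp Dp1) ≤ right t Dp1
raised-middle-bounds t Dp _ _ _ (xE i) (aE j) (c₁ , _ , _ , c₄ , _) =
  c₁ , subst (_≤ i + t) (sym (+-suc (suc j) t)) (c₄ (i , refl))
raised-middle-bounds t Dp _ _ _ (yE L) (aE j) (c₁ , c₂ , _ , _ , c₅) with suc j ≟ L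
... | yes refl rewrite ==-refl (suc j + t) = left≤ , ≤-refl
  where
    left≤ : left t Dp ≤ left (suc t) (y (suc j + t))
    left≤ rewrite left-y-suc j t = ≤-pred (subst (left t Dp <_) (left-y (suc j) t) c₅)
... | no 1+j≢L rewrite ==-≢ (1+j≢L ∘ +-cancelʳ-≡ t _ _) =
  c₁ , subst (_≤ L + t) (sym (+-suc (suc j) t)) (≤∧≢⇒< c₂ (1+j≢L ∘ +-cancelʳ-≡ t _ _))
raised-middle-bounds t _ Dp1 _ (xE i) Dp1-x (bE j) (c₁ , c₂ , _ , c₄ , c₅) with suc j ≟ i
... | yes refl rewrite ==-refl j = ≤-refl , right≥ Dp1-x c₂ c₄ c₅
  where
    right≥ : XEntry t Dp1 → suc j + t ≤ right t Dp1 → (IsX Dp1 → suc j + t < right t Dp1) → suc j < left t Dp1 →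
             suc j + suc t ≤ right t Dp1
    right≥ (xE i') _ c₄ _ = subst (_≤ i' + t) (sym (+-suc (suc j) t)) (c₄ (i' , refl))
    right≥ (yE L) c₂ _ c₅ rewrite left-y L t with suc j + t ≟ L + t
    ... | yes eq = ⊥-elim (<-irrefl (+-cancelʳ-≡ t _ _ eq) c₅)
    ... | no ≢   = subst (_≤ L + t) (sym (+-suc (suc j) t)) (≤∧≢⇒< c₂ ≢)
... | no 1+j≢i rewrite ==-≢ 1+j≢i = left≤ , c₂
  where
    left≤ : i ≤ left (suc t) (y (suc j + t))
    left≤ rewrite left-y-suc j t = ≤-pred (≤∧≢⇒< c₁ (1+j≢i ∘ sym))
raised-middle-bounds t _ _ _ (yE L) _ (bE j) (_ , c₂ , c₃ , _ , _) = left≤ , c₂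
  where
    left≤ : left t (y (L + t)) ≤ left (suc t) (y (suc j + t))
    left≤ rewrite left-y-suc j t = ≤-pred (c₃ (L + t , refl))

-- The arrangement conditions force Dp1 to be x_(J+1) or y_(J+t), where J = left Up, and neither is
-- compatible with how Up and Up1 were converted.
raised-¬x-then-y : ∀ t Up Up1 Dp Dp1 Dp2 (Up-v : VEntry t Up) (Up1-v : VEntry t Up1) → predLeft Up1-v ≡ suc (predLeft Up-v) →
  XEntry t Dp1 → ArrCondℕ t t Dp Up Dp1 → ArrCondℕ t t Dp1 Up1 Dp2 →
  toX Up Dp Dp1 ≡ x (suc (predLeft Up-v)) → toX Up1 Dp1 Dp2 ≡ y (suc (predLeft Up1-v) + t) → ⊥
raised-¬x-then-y t Up Up1 Dp _ Dp2 Up-v Up1-v adjacent (xE i) A₁ A₂ eq₁ eq₂ = contradiction Up1-v refl i≡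
  where
    i> : suc (predLeft Up-v) < i
    i> = +-cancelʳ-< t (suc (predLeft Up-v)) i
           (subst (_< i + t) (right-VEntry Up-v) (proj₁ (proj₂ (proj₂ (proj₂ A₁))) (i , refl)))
    i≡ : i ≡ suc (predLeft Up1-v)
    i≡ = ≤-antisym (subst (i ≤_) (left-VEntry Up1-v) (proj₁ A₂)) (subst (_≤ i) (cong suc (sym adjacent)) i>)
    contradiction : (Up1-v' : VEntry t Up1) → Up1-v' ≡ Up1-v → i ≡ suc (predLeft Up1-v') → ⊥
    contradiction (aE j) refl i≡' with xFromA≡y (suc j) (suc j + t) Dp2 _ eq₂
    ... | refl = <-irrefl (trans i≡' (sym (left-y (suc j) t))) (proj₂ (proj₂ (proj₂ (proj₂ A₂))))
    contradiction (bE j) refl refl rewrite ==-refl (suc j) = x≢y eq₂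
raised-¬x-then-y t Up Up1 Dp _ Dp2 Up-v Up1-v adjacent (yE L) A₁ A₂ eq₁ eq₂ = contradiction Up-v refl L≡
  where
    L≥ : suc (predLeft Up-v) ≤ L
    L≥ = +-cancelʳ-≤ t (suc (predLeft Up-v)) L (subst (_≤ L + t) (right-VEntry Up-v) (proj₁ (proj₂ A₁)))
    L< : L < suc (predLeft Up1-v)
    L< = subst (_< suc (predLeft Up1-v)) (left-y L t)
           (subst (left t (y (L + t)) <_) (left-VEntry Up1-v) (proj₁ (proj₂ (proj₂ A₂)) (L + t , refl)))
    L≡ : L ≡ suc (predLeft Up-v)
    L≡ = ≤-antisym (subst (L ≤_) adjacent (≤-pred L<)) L≥
    contradiction : (Up-v' : VEntry t Up) → Up-v' ≡ Up-v → L ≡ suc (predLeft Up-v') → ⊥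
    contradiction (aE j) refl refl rewrite ==-refl (suc j + t) = x≢y (sym eq₁)
    contradiction (bE j) refl refl with xFromB≡x (suc j) (suc j + t) Dp _ eq₁
    ... | refl = <-irrefl (sym (left-y (suc j) t)) (proj₂ (proj₂ (proj₂ (proj₂ A₁))))

raised-upper-arranged : ∀ t Up Up1 Dp Dp1 Dp2 Fp → VEntry t Up → VEntry t Up1 → XEntry t Dp1 →
  ArrCondℕ t (suc t) Up Fp Up1 → ArrCondℕ t t Dp Up Dp1 → ArrCondℕ t t Dp1 Up1 Dp2 →
  ArrCondℕ (suc t) (suc t) (toX Up Dp Dp1) Fp (toX Up1 Dp1 Dp2)
raised-upper-arranged t Up Up1 Dp Dp1 Dp2 Fp Up-v Up1-v Dp1-x (f₁ , f₂ , _ , _ , f₅) A₁ A₂ =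
  ≤-trans (endpoint-left≤ end₁) f₁' ,
  ≤-trans f₂' (endpoint-right≥ end₂) ,
  (λ y₁ → <-≤-trans (endpoint-left< end₁ y₁) f₁') ,
  (λ x₂ → ≤-<-trans f₂' (endpoint-right> end₂ x₂)) ,
  left< end₁ end₂
  where
    j₁ = predLeft Up-v
    j₂ = predLeft Up1-v
    end₁ = toX-endpoint t Up Dp Dp1 Up-v
    end₂ = toX-endpoint t Up1 Dp1 Dp2 Up1-v
    f₁' : suc j₁ ≤ left (suc t) Fp
    f₁' = subst (_≤ left (suc t) Fp) (left-VEntry Up-v) f₁
    f₂' : right (suc t) Fp ≤ suc j₂ + t
    f₂' = subst (right (suc t) Fp ≤_) (right-VEntry Up1-v) f₂
    f₅' : suc j₁ < suc j₂
    f₅' = subst₂ _<_ (left-VEntry Up-v) (left-VEntry Up1-v) f₅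
    left< : Endpoint t (suc j₁) (toX Up Dp Dp1) → Endpoint t (suc j₂) (toX Up1 Dp1 Dp2) →
            left (suc t) (toX Up Dp Dp1) < left (suc t) (toX Up1 Dp1 Dp2)
    left< (inj₂ eq₁) end₂' rewrite eq₁ | left-y-suc j₁ t = ≤-trans (≤-pred f₅') (endpoint-left≥ end₂')
    left< (inj₁ eq₁) (inj₁ eq₂) rewrite eq₁ | eq₂ = f₅'
    left< (inj₁ eq₁) (inj₂ eq₂) with suc j₁ ≟ j₂
    ... | yes adjacent = ⊥-elim (raised-¬x-then-y t Up Up1 Dp Dp1 Dp2 Up-v Up1-v (sym adjacent) Dp1-x A₁ A₂ eq₁ eq₂)
    ... | no ≢ rewrite eq₁ | eq₂ | left-y-suc j₂ t = ≤∧≢⇒< (≤-pred f₅') ≢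

LoweredValues : ∀ t {s} → XEntry (suc t) s → Sym → Set
LoweredValues t (xE i) v = left t v ≡ i × right t v ≡ i + t
LoweredValues t (yE L) v = left t v ≡ suc L × right t v ≡ L + suc t

toV-lowered-values : ∀ t s u u' (s-x : XEntry (suc t) s) → Spans t u → Spans t u' →
  LoweredValues t s-x (toV t s u u') × IsAB (toV t s u u')
toV-lowered-values t _ u u' (xE i) u-spans _ with vFromX-values t i u u' u-spans
... | left≡ , right≡ , ab = (left≡ , right≡) , ab
toV-lowered-values t _ u u' (yE L) _ u'-spans with vFromY-values t (L + suc t) u u' u'-spans
... | left≡ , right≡ , ab = (trans left≡ (trans (cong (_∸ t) (+-suc L t)) (m+n∸n≡m (suc L) t)) , right≡) , ab

lowered-left≥ : ∀ {t s v} (s-x : XEntry (suc t) s) → LoweredValues t s-x v → left (suc t) s ≤ left t v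
lowered-left≥     (xE i) (left≡ , _) = ≤-reflexive (sym left≡)
lowered-left≥ {t} (yE L) (left≡ , _) rewrite left-y L (suc t) | left≡ = n≤1+n L

lowered-right≤ : ∀ {t s v} (s-x : XEntry (suc t) s) → LoweredValues t s-x v → right t v ≤ right (suc t) s
lowered-right≤ {t} (xE i) (_ , right≡) rewrite right≡ = +-monoʳ-≤ i (n≤1+n t)
lowered-right≤     (yE L) (_ , right≡) rewrite right≡ = ≤-refl

LoweredValues-left≥1 : ∀ {t s v} (s-x : XEntry (suc t) s) → 1 ≤ left (suc t) s → LoweredValues t s-x v → 1 ≤ left t v
LoweredValues-left≥1 (xE i) 1≤i (left≡ , _) = subst (1 ≤_) (sym left≡) 1≤i
LoweredValues-left≥1 (yE L) _   (left≡ , _) = subst (1 ≤_) (sym left≡) (s≤s z≤n)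

LoweredValues-interval : ∀ {t s v} (s-x : XEntry (suc t) s) → LoweredValues t s-x v → right t v ≡ left t v + t
LoweredValues-interval     (xE i) (left≡ , right≡) = trans right≡ (cong (_+ _) (sym left≡))
LoweredValues-interval {t} (yE L) (left≡ , right≡) = trans right≡ (trans (+-suc L t) (cong (_+ t) (sym left≡)))

YXGap : ℕ → Sym → Sym → Set
YXGap t u w = ∀ L i → u ≡ y (L + t) → w ≡ x i → suc L < i

-- The entry above y_(L+t) and x_i has its left value strictly between L and i.
y-x-gap : ∀ t L i Fp → right t Fp ≡ left t Fp + t → ArrCondℕ t t (y (L + t)) Fp (x i) → suc L < i
y-x-gap t L i Fp Fp-interval (_ , _ , c₃ , c₄ , _) =
  ≤-<-trans (subst (_< left t Fp) (left-y L t) (c₃ (L + t , refl)))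
            (+-cancelʳ-< t (left t Fp) i (subst (_< i + t) Fp-interval (c₄ (i , refl))))

lowered-middle-arranged : ∀ t Dp Dp1 Um Up Up1 (Dp-v : VEntry t Dp) (Dp1-v : VEntry t Dp1) → XEntry (suc t) Up →
  YXGap (suc t) Um Up → YXGap (suc t) Up Up1 → ArrCondℕ t (suc t) Dp Up Dp1 →
  ArrCondℕ t t (toX Dp Up Um) (toV t Up Dp Dp1) (toX Dp1 Up1 Up)
lowered-middle-arranged t Dp Dp1 Um Up Up1 Dp-v Dp1-v Up-x gap-left gap-right (c₁ , c₂ , c₃ , c₄ , c₅) =
  ≤-trans (≤-reflexive left₀) (≤-trans c₁ (lowered-left≥ Up-x values)) ,
  ≤-trans (lowered-right≤ Up-x values) (≤-trans c₂ (≤-reflexive (sym right₁))) ,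
  left< Dp-v Up-x values ,
  (λ x₁ → subst (right t (toV t Up Dp Dp1) <_) (sym right₁) (right< Dp1-v Up-x values x₁)) ,
  subst₂ _<_ (sym left₀) (sym left₁) c₅
  where
    values = proj₁ (toV-lowered-values t Up Dp Dp1 Up-x (VEntry⇒Spans Dp-v) (VEntry⇒Spans Dp1-v))
    left₀ = proj₁ (proj₂ (toX-values t Dp Up Um Dp-v))
    left₁ = proj₁ (proj₂ (toX-values t Dp1 Up1 Up Dp1-v))
    right₁ = proj₂ (proj₂ (toX-values t Dp1 Up1 Up Dp1-v))
    left< : VEntry t Dp → (Up-x : XEntry (suc t) Up) → LoweredValues t Up-x (toV t Up Dp Dp1) → IsY (toX Dp Up Um) →
            left t (toX Dp Up Um) < left t (toV t Up Dp Dp1)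
    left< _ (yE L) (left≡ , _) _ rewrite left≡ | left₀ = s≤s (subst (left t Dp ≤_) (left-y L (suc t)) c₁)
    left< (aE j) (xE i) (left≡ , _) (k , y₀) rewrite left≡ =
      subst (_< i) (sym left₀) (gap-left j i (trans (xFromA≡y (suc j) (suc j + t) Um k y₀) (cong y (sym (+-suc j t)))) refl)
    left< (bE j) (xE i) (left≡ , _) (k , y₀) rewrite left≡ =
      subst (_< i) (sym left₀) (≤∧≢⇒< c₁ (xFromB-x≡y⇒≢ (suc j) (suc j + t) i k y₀))
    right< : VEntry t Dp1 → (Up-x : XEntry (suc t) Up) → LoweredValues t Up-x (toV t Up Dp Dp1) → IsX (toX Dp1 Up1 Up) →
             right t (toV t Up Dp Dp1) < right t Dp1
    right< _ (xE i) (_ , right≡) _ rewrite right≡ = subst (_≤ right t Dp1) (+-suc i t) c₂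
    right< (aE j) (yE L) (_ , right≡) (i , x₁) rewrite right≡ =
      ≤∧≢⇒< c₂ (xFromA-y≡x⇒≢ (suc j) (suc j + t) (L + suc t) i x₁ ∘ sym)
    right< (bE j) (yE L) (_ , right≡) (i , x₁) rewrite right≡ =
      subst (_≤ suc j + t) (sym (cong suc (+-suc L t)))
        (+-monoˡ-≤ t (gap-right L (suc j) refl (xFromB≡x (suc j) (suc j + t) Up1 i x₁)))

lowered-upper-arranged : ∀ t Up Up1 Fp Dp Dp1 Dp2 → XEntry (suc t) Up → XEntry (suc t) Up1 →
  VEntry t Dp → VEntry t Dp1 → VEntry t Dp2 →
  right (suc t) Fp ≡ left (suc t) Fp + suc t → ArrCondℕ (suc t) (suc t) Up Fp Up1 →
  ArrCondℕ t (suc t) (toV t Up Dp Dp1) Fp (toV t Up1 Dp1 Dp2)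
lowered-upper-arranged t Up Up1 Fp Dp Dp1 Dp2 Up-x Up1-x Dp-v Dp1-v Dp2-v Fp-interval A@(f₁ , f₂ , f₃ , f₄ , f₅) =
  left≤ Up-x values₀ , right≥ Up1-x values₁ ,
  (λ y₀ → ⊥-elim (IsAB⇒¬IsY ab₀ y₀)) , (λ x₁ → ⊥-elim (IsAB⇒¬IsX ab₁ x₁)) ,
  left< Up-x Up1-x values₀ values₁
  where
    lowered₀ = toV-lowered-values t Up Dp Dp1 Up-x (VEntry⇒Spans Dp-v) (VEntry⇒Spans Dp1-v)
    lowered₁ = toV-lowered-values t Up1 Dp1 Dp2 Up1-x (VEntry⇒Spans Dp1-v) (VEntry⇒Spans Dp2-v)
    values₀ = proj₁ lowered₀
    ab₀ = proj₂ lowered₀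
    values₁ = proj₁ lowered₁
    ab₁ = proj₂ lowered₁
    left≤ : (Up-x : XEntry (suc t) Up) → LoweredValues t Up-x (toV t Up Dp Dp1) → left t (toV t Up Dp Dp1) ≤ left (suc t) Fp
    left≤ (xE i) (left≡ , _) rewrite left≡ = f₁
    left≤ (yE L) (left≡ , _) rewrite left≡ = subst (_< left (suc t) Fp) (left-y L (suc t)) (f₃ (L + suc t , refl))
    right≥ : (Up1-x : XEntry (suc t) Up1) → LoweredValues t Up1-x (toV t Up1 Dp1 Dp2) → right (suc t) Fp ≤ right t (toV t Up1 Dp1 Dp2)
    right≥ (xE i) (_ , right≡) rewrite right≡ = ≤-pred (subst (right (suc t) Fp <_) (+-suc i t) (f₄ (i , refl)))
    right≥ (yE L) (_ , right≡) rewrite right≡ = f₂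
    left< : (Up-x : XEntry (suc t) Up) (Up1-x : XEntry (suc t) Up1) →
            LoweredValues t Up-x (toV t Up Dp Dp1) → LoweredValues t Up1-x (toV t Up1 Dp1 Dp2) →
            left t (toV t Up Dp Dp1) < left t (toV t Up1 Dp1 Dp2)
    left< (xE i) (xE i') (left≡ , _) (left≡' , _) rewrite left≡ | left≡' = f₅
    left< (xE i) (yE L') (left≡ , _) (left≡' , _) rewrite left≡ | left≡' | left-y L' (suc t) = ≤-trans f₅ (n≤1+n L')
    left< (yE L) (yE L') (left≡ , _) (left≡' , _) rewrite left≡ | left≡' | left-y L' (suc t) | left-y L (suc t) = s≤s f₅
    left< (yE L) (xE i') (left≡ , _) (left≡' , _) rewrite left≡ | left≡' = y-x-gap (suc t) L i' Fp Fp-interval A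

-- Admissible triangles

Entries : ℕ → List Sym → Set
Entries n = All (λ s → InX n s ⊎ ∃ λ k → InV n k s)

RankStep : ℕ → Tri → (ℕ → ℕ) → ℕ → Set
RankStep n T ρ r = (XRow n T r × ρ (r ∸ 1) ≡ ρ r) ⊎ (All (InV n (ρ r)) (row T r) × ρ (r ∸ 1) ≡ suc (ρ r))

-- E is the lower row (entries u and w) and V the row above it (entry v); Arranged T ρ e is the
-- conjunct of ArrOK for rows e and e - 1.
ArrangedRows : ℕ → ℕ → ℕ → List Sym → List Sym → Set
ArrangedRows te tv m E V = ∀ p {u v w} → 1 ≤ p → p ≤ m →
  at E p ≡ just u → at V p ≡ just v → at E (suc p) ≡ just w → ArrCond te tv u v w

Arranged : Tri → (ℕ → ℕ) → ℕ → Set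
Arranged T ρ e = ArrangedRows (ρ e) (ρ (e ∸ 1)) (e ∸ 1) (row T e) (row T (e ∸ 1))

ArrangedRows-cong : ∀ {te te' tv tv' m E E' V V'} → te ≡ te' → tv ≡ tv' → E ≡ E' → V ≡ V' →
  ArrangedRows te tv m E V → ArrangedRows te' tv' m E' V'
ArrangedRows-cong refl refl refl refl arranged = arranged

InX⇒¬InV : ∀ {n k s} → InX n s → InV n k s → ⊥
InX⇒¬InV (inx _ _) ()
InX⇒¬InV (iny _ _) ()

XRow∧VRow⇒empty : ∀ {n k} (l : List Sym) → All (InX n) l → All (InV n k) l → length l ≡ 0
XRow∧VRow⇒empty []      _         _         = refl
XRow∧VRow⇒empty (_ ∷ _) (s-x ∷ _) (s-v ∷ _) = ⊥-elim (InX⇒¬InV s-x s-v)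

XEntry-of : ∀ {n t s} → InX n s → LeftNatural t s → XEntry t s
XEntry-of (inx _ _) _ = xE _
XEntry-of {t = t} (iny {j} _ _) t≤j = subst (XEntry t ∘ y) (m∸n+n≡m t≤j) (yE (j ∸ t))

VEntry-of : ∀ {n t s} → InV n t s → VEntry t s
VEntry-of (ina {suc i} _ _ _ refl) = aE i
VEntry-of (inb {suc i} _ _ _ refl) = bE i

InV⇒Spans : ∀ {n t s} → InV n t s → Spans t s
InV⇒Spans (ina _ _ _ j≡i+t) = j≡i+t
InV⇒Spans (inb _ _ _ j≡i+t) = j≡i+t

InV⇒LeftNatural : ∀ {n t s} → InV n t s → LeftNatural t s
InV⇒LeftNatural (ina _ _ _ _) = tt
InV⇒LeftNatural (inb _ _ _ _) = tt

IsAB⇒LeftNatural : ∀ {t s} → IsAB s → LeftNatural t s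
IsAB⇒LeftNatural (_ , _ , inj₁ refl) = tt
IsAB⇒LeftNatural (_ , _ , inj₂ refl) = tt

InX-interval : ∀ {n t s} → InX n s → LeftNatural t s → right t s ≡ left t s + t
InX-interval (inx _ _) _   = refl
InX-interval (iny _ _) t≤j = sym (m∸n+n≡m t≤j)

InV-interval : ∀ {n t s} → InV n t s → right t s ≡ left t s + t
InV-interval (ina _ _ _ j≡i+t) = j≡i+t
InV-interval (inb _ _ _ j≡i+t) = j≡i+t

lval≥1⇒LeftNatural : ∀ t s → + 1 ℤ.≤ lval t s → LeftNatural t s
lval≥1⇒LeftNatural t (x i)   _ = tt
lval≥1⇒LeftNatural t (a i j) _ = tt
lval≥1⇒LeftNatural t (b i j) _ = tt
lval≥1⇒LeftNatural t (num i) _ = tt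
lval≥1⇒LeftNatural t (y j) 1≤j-t with t ≤? j
... | yes t≤j = t≤j
... | no  t≰j = ⊥-elim (¬1≤-k (t ∸ j) (subst (+ 1 ℤ.≤_) (trans (ℤ.m-n≡m⊖n j t) (ℤ.⊖-< (≰⇒> t≰j))) 1≤j-t))
  where
    ¬1≤-k : ∀ k → + 1 ℤ.≤ ℤ.- (+ k) → ⊥
    ¬1≤-k zero    (+≤+ ())
    ¬1≤-k (suc k) ()

InRange : ℕ → ℕ → Sym → Set
InRange n t s = + 1 ℤ.≤ lval t s × rval t s ℤ.≤ + n

module AdmissibleFacts {n T ρ} (adm : AdmissibleWith n T ρ) where

  length-T : length T ≡ n
  length-T = proj₁ (proj₁ (proj₁ adm))

  length-row : ∀ r → 1 ≤ r → r ≤ n → length (row T r) ≡ r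
  length-row = proj₁ (proj₂ (proj₁ (proj₁ adm)))

  row-n : row T n ≡ map num (positions n)
  row-n = proj₂ (proj₂ (proj₁ (proj₁ adm)))

  entries : ∀ r → 1 ≤ r → r ≤ n ∸ 1 → Entries n (row T r)
  entries = proj₂ (proj₁ adm)

  rank-n : ρ n ≡ 0
  rank-n = proj₁ (proj₁ (proj₂ adm))

  rank-n-1 : ρ (n ∸ 1) ≡ 1
  rank-n-1 = proj₁ (proj₂ (proj₁ (proj₂ adm)))

  rankStep : ∀ r → 1 ≤ r → r ≤ n ∸ 1 → RankStep n T ρ r
  rankStep = proj₂ (proj₂ (proj₁ (proj₂ adm)))

  arranged : ∀ e → 2 ≤ e → e ≤ n → Arranged T ρ e
  arranged e 2≤e e≤n p = proj₂ (proj₂ adm) e p _ _ _ 2≤e e≤n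

  row-nonempty : ∀ r → 1 ≤ r → r ≤ n ∸ 1 → length (row T r) ≢ 0
  row-nonempty r 1≤r r≤n-1 len≡0 =
    1+n≰n (subst (1 ≤_) (trans (sym (length-row r 1≤r (≤-trans r≤n-1 (m∸n≤m n 1)))) len≡0) 1≤r)


  length-row₀ : ∀ r → r ≤ n → length (row T r) ≡ r
  length-row₀ zero    _   = refl
  length-row₀ (suc r) r≤n = length-row (suc r) (s≤s z≤n) r≤n

  XRow⇒rank : ∀ r → 1 ≤ r → r ≤ n ∸ 1 → XRow n T r → ρ (r ∸ 1) ≡ ρ r
  XRow⇒rank r 1≤r r≤n-1 x-row with rankStep r 1≤r r≤n-1
  ... | inj₁ (_ , ρ≡) = ρ≡
  ... | inj₂ (v-row , _) = ⊥-elim (row-nonempty r 1≤r r≤n-1 (XRow∧VRow⇒empty (row T r) x-row v-row))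

  VRow⇒rank : ∀ r → 1 ≤ r → r ≤ n ∸ 1 → VRow n T r → All (InV n (ρ r)) (row T r) × ρ (r ∸ 1) ≡ suc (ρ r)
  VRow⇒rank r 1≤r r≤n-1 (_ , v-row) with rankStep r 1≤r r≤n-1
  ... | inj₁ (x-row , _) = ⊥-elim (row-nonempty r 1≤r r≤n-1 (XRow∧VRow⇒empty (row T r) x-row v-row))
  ... | inj₂ result = result

  VRow⇒InV : ∀ r → r ≤ n ∸ 1 → VRow n T r → All (InV n (ρ r)) (row T r)
  VRow⇒InV zero    _       _     = []
  VRow⇒InV (suc r) r≤n-1 v-row = proj₁ (VRow⇒rank (suc r) (s≤s z≤n) r≤n-1 v-row)

  private
    RowInRange : ℕ → Set
    RowInRange r = 1 ≤ r → ∀ p {s} → at (row T r) p ≡ just s → InRange n (ρ r) s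

    in-range-n : RowInRange n
    in-range-n _ p {s} at≡s with at-just⇒bounds (row T n) at≡s
    ... | 1≤p , p≤len
      with trans (sym at≡s) (trans (cong (λ l → at l p) row-n) (at-map-positions num 1≤p p≤n))
      where p≤n = subst (p ≤_) (trans (cong length row-n) (length-map-positions num n)) p≤len
    ... | refl = +≤+ 1≤p , +≤+ (subst (p ≤_) (trans (cong length row-n) (length-map-positions num n)) p≤len)

    in-range-above : ∀ r → suc r ≤ n → RowInRange (suc r) → RowInRange r
    in-range-above r r<n below 1≤r p at≡v
      with at-just⇒bounds (row T r) at≡v
    ... | 1≤p , p≤len
      with at-within (row T (suc r)) 1≤p (subst (p ≤_) (sym len-below) (≤-trans p≤r (n≤1+n r)))
         | at-within (row T (suc r)) (s≤s z≤n) (subst (suc p ≤_) (sym len-below) (s≤s p≤r))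
      where
        p≤r = subst (p ≤_) (length-row r 1≤r (≤-trans (n≤1+n r) r<n)) p≤len
        len-below = length-row (suc r) (s≤s z≤n) r<n
    ... | _ , at≡u | _ , at≡w =
      let c = arranged (suc r) (s≤s 1≤r) r<n p 1≤p p≤r at≡u at≡v at≡w
      in ℤ.≤-trans (proj₁ (below (s≤s z≤n) p at≡u)) (proj₁ c) ,
         ℤ.≤-trans (proj₁ (proj₂ c)) (proj₂ (below (s≤s z≤n) (suc p) at≡w))
      where p≤r = subst (p ≤_) (length-row r 1≤r (≤-trans (n≤1+n r) r<n)) p≤len

  -- The interval of each entry lies within the hull of the two entries below it, and row n is 1, …, n.
  in-range : ∀ r → 1 ≤ r → r ≤ n → ∀ p {s} → at (row T r) p ≡ just s → InRange n (ρ r) s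
  in-range r 1≤r r≤n = downward-induction RowInRange in-range-n in-range-above r r≤n 1≤r

  module _ r (1≤r : 1 ≤ r) (r≤n : r ≤ n) p {s} (at≡s : at (row T r) p ≡ just s) where
    private
      range = in-range r 1≤r r≤n p at≡s

    leftNatural-at : LeftNatural (ρ r) s
    leftNatural-at = lval≥1⇒LeftNatural (ρ r) s (proj₁ range)

    left≥1-at : 1 ≤ left (ρ r) s
    left≥1-at = ℤ.drop‿+≤+ (subst (+ 1 ℤ.≤_) (lval≡left (ρ r) s leftNatural-at) (proj₁ range))

    right≤n-at : right (ρ r) s ≤ n
    right≤n-at = ℤ.drop‿+≤+ (subst (ℤ._≤ + n) (rval≡right (ρ r) s) (proj₂ range))

  interval-at : ∀ r → 1 ≤ r → r ≤ n ∸ 1 → ∀ p {s} → at (row T r) p ≡ just s → right (ρ r) s ≡ left (ρ r) s + ρ r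
  interval-at r 1≤r r≤n-1 p at≡s with rankStep r 1≤r r≤n-1
  ... | inj₁ (x-row , _) = InX-interval (All-at (row T r) x-row p at≡s) (leftNatural-at r 1≤r (≤-trans r≤n-1 (m∸n≤m n 1)) p at≡s)
  ... | inj₂ (v-row , _) = InV-interval (All-at (row T r) v-row p at≡s)

  rank≥1 : ∀ r → 1 ≤ r → r ≤ n ∸ 1 → 1 ≤ ρ r
  rank≥1 r 1≤r r≤n-1 = downward-induction (λ r → 1 ≤ r → 1 ≤ ρ r) (λ _ → ≤-reflexive (sym rank-n-1)) step r r≤n-1 1≤r
    where
      step : ∀ r → suc r ≤ n ∸ 1 → (1 ≤ suc r → 1 ≤ ρ (suc r)) → 1 ≤ r → 1 ≤ ρ r
      step r r<n-1 ρ-below _ with rankStep (suc r) (s≤s z≤n) r<n-1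
      ... | inj₁ (_ , ρr≡) = subst (1 ≤_) (sym ρr≡) (ρ-below (s≤s z≤n))
      ... | inj₂ (_ , ρr≡) = subst (1 ≤_) (sym ρr≡) (s≤s z≤n)

ranking-unique : ∀ {n T ρ₁ ρ₂} → AdmissibleWith n T ρ₁ → AdmissibleWith n T ρ₂ → ∀ r → 1 ≤ r → r ≤ n ∸ 1 → ρ₁ r ≡ ρ₂ r
ranking-unique {n} {T} {ρ₁} {ρ₂} adm₁ adm₂ r 1≤r r≤n-1 =
  downward-induction (λ r → 1 ≤ r → ρ₁ r ≡ ρ₂ r) (λ _ → trans F₁.rank-n-1 (sym F₂.rank-n-1)) step r r≤n-1 1≤r
  where
    module F₁ = AdmissibleFacts adm₁
    module F₂ = AdmissibleFacts adm₂
    step : ∀ r → suc r ≤ n ∸ 1 → (1 ≤ suc r → ρ₁ (suc r) ≡ ρ₂ (suc r)) → 1 ≤ r → ρ₁ r ≡ ρ₂ r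
    step r r<n-1 ρ-below _ with F₁.rankStep (suc r) (s≤s z≤n) r<n-1 | F₂.rankStep (suc r) (s≤s z≤n) r<n-1
    ... | inj₁ (_ , eq₁) | inj₁ (_ , eq₂) = trans eq₁ (trans (ρ-below (s≤s z≤n)) (sym eq₂))
    ... | inj₂ (_ , eq₁) | inj₂ (_ , eq₂) = trans eq₁ (trans (cong suc (ρ-below (s≤s z≤n))) (sym eq₂))
    ... | inj₁ (x-row , _) | inj₂ (v-row , _) =
      ⊥-elim (F₁.row-nonempty (suc r) (s≤s z≤n) r<n-1 (XRow∧VRow⇒empty (row T (suc r)) x-row v-row))
    ... | inj₂ (v-row , _) | inj₁ (x-row , _) =
      ⊥-elim (F₁.row-nonempty (suc r) (s≤s z≤n) r<n-1 (XRow∧VRow⇒empty (row T (suc r)) x-row v-row))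

XRow∧VRow⇒⊥ : ∀ {n S ρ r} → AdmissibleWith n S ρ → 1 ≤ r → r ≤ n ∸ 1 → XRow n S r → VRow n S r → ⊥
XRow∧VRow⇒⊥ {S = S} {r = r} adm 1≤r r≤n-1 x-row (_ , v-row) =
  AdmissibleFacts.row-nonempty adm r 1≤r r≤n-1 (XRow∧VRow⇒empty (row S r) x-row v-row)

RankStep-cong : ∀ {n T T' ρ ρ'} r → row T' r ≡ row T r → ρ' r ≡ ρ r → ρ' (r ∸ 1) ≡ ρ (r ∸ 1) →
  RankStep n T ρ r → RankStep n T' ρ' r
RankStep-cong r row-r ρ-r ρ-r-1 step rewrite row-r | ρ-r | ρ-r-1 = step

module _ {n T ρ} (adm : AdmissibleWith n T ρ) {e} (e<n-1 : suc e ≤ n ∸ 1) {U D : List Sym} {ρ' : ℕ → ℕ}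
  (ρ'-other : ∀ r → r ≢ e → ρ' r ≡ ρ r)
  (length-D : length D ≡ suc e) (entries-D : Entries n D) (step-D : RankStep n (replaceRows e U D T) ρ' (suc e))
  (upper : 1 ≤ e → length U ≡ e × Entries n U × RankStep n (replaceRows e U D T) ρ' e)
  (arranged-below : Arranged (replaceRows e U D T) ρ' (suc (suc e)))
  (arranged-middle : Arranged (replaceRows e U D T) ρ' (suc e))
  (arranged-above : Arranged (replaceRows e U D T) ρ' e)
  where

  private
    open AdmissibleFacts adm
    T' = replaceRows e U D T
    e<n : suc e ≤ n
    e<n = ≤-trans e<n-1 (m∸n≤m n 1)
    unchanged : ∀ {r} → r ≢ e → r ≢ suc e → row T' r ≡ row T r
    unchanged = row-replaceRows-other e U D T
    row-lower : row T' (suc e) ≡ D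
    row-lower = row-replaceRows-lower e U D T (subst (suc e ≤_) (sym length-T) e<n)
    row-upper : length U ≡ e → row T' e ≡ U
    row-upper = row-replaceRows-upper e U D T (subst (e ≤_) (sym length-T) (≤-trans (n≤1+n e) e<n))
    n≢e : n ≢ e
    n≢e refl = 1+n≰n e<n
    n≢1+e : n ≢ suc e
    n≢1+e refl = 1+n≰n e<n-1
    n-1≢e : n ∸ 1 ≢ e
    n-1≢e refl = 1+n≰n e<n-1

    length-row' : ∀ r → 1 ≤ r → r ≤ n → length (row T' r) ≡ r
    length-row' r 1≤r r≤n with r ≟ suc e | r ≟ e
    ... | yes refl | _        = trans (cong length row-lower) length-D
    ... | no _     | yes refl = trans (cong length (row-upper (proj₁ (upper 1≤r)))) (proj₁ (upper 1≤r))
    ... | no r≢1+e | no r≢e   = trans (cong length (unchanged r≢e r≢1+e)) (length-row r 1≤r r≤n)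

    entries' : ∀ r → 1 ≤ r → r ≤ n ∸ 1 → Entries n (row T' r)
    entries' r 1≤r r≤n-1 with r ≟ suc e | r ≟ e
    ... | yes refl | _        = subst (Entries n) (sym row-lower) entries-D
    ... | no _     | yes refl = subst (Entries n) (sym (row-upper (proj₁ (upper 1≤r)))) (proj₁ (proj₂ (upper 1≤r)))
    ... | no r≢1+e | no r≢e   = subst (Entries n) (sym (unchanged r≢e r≢1+e)) (entries r 1≤r r≤n-1)

    rankStep' : ∀ r → 1 ≤ r → r ≤ n ∸ 1 → RankStep n T' ρ' r
    rankStep' r 1≤r r≤n-1 with r ≟ suc e | r ≟ e
    ... | yes refl | _        = step-D
    ... | no _     | yes refl = proj₂ (proj₂ (upper 1≤r))
    rankStep' (suc r) 1≤r r≤n-1 | no r≢1+e | no r≢e =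
      RankStep-cong {T = T} {T'} {ρ} {ρ'} (suc r) (unchanged r≢e r≢1+e) (ρ'-other (suc r) r≢e) (ρ'-other r (r≢1+e ∘ cong suc))
        (rankStep (suc r) 1≤r r≤n-1)

    arranged' : ∀ e' → 2 ≤ e' → e' ≤ n → Arranged T' ρ' e'
    arranged' (suc (suc f)) (s≤s (s≤s z≤n)) e'≤n with f ≟ e | suc f ≟ e | suc (suc f) ≟ e
    ... | yes refl | _        | _        = arranged-below
    ... | no _     | yes refl | _        = arranged-middle
    ... | no _     | no _     | yes refl = arranged-above
    ... | no f≢e   | no 1+f≢e | no 2+f≢e =
      ArrangedRows-cong (sym (ρ'-other _ 2+f≢e)) (sym (ρ'-other _ 1+f≢e))
        (sym (unchanged 2+f≢e (1+f≢e ∘ suc-injective))) (sym (unchanged 1+f≢e (f≢e ∘ suc-injective)))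
        (arranged (suc (suc f)) (s≤s (s≤s z≤n)) e'≤n)

  admissible-replaceRows : AdmissibleWith n (replaceRows e U D T) ρ'
  admissible-replaceRows =
    ((trans (length-replaceRows e U D T) length-T , length-row' , trans (unchanged n≢e n≢1+e) row-n) , entries') ,
    (trans (ρ'-other n n≢e) rank-n , trans (ρ'-other (n ∸ 1) n-1≢e) rank-n-1 , rankStep') ,
    λ e' p _ _ _ 2≤e' e'≤n → arranged' e' 2≤e' e'≤n p

setRank : (ℕ → ℕ) → ℕ → ℕ → ℕ → ℕ
setRank ρ e k r = if r == e then k else ρ r

setRank-≡ : ∀ ρ e k → setRank ρ e k e ≡ k
setRank-≡ ρ e k rewrite ==-refl e = refl

setRank-≢ : ∀ ρ e k {r} → r ≢ e → setRank ρ e k r ≡ ρ r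
setRank-≢ ρ e k r≢e rewrite ==-≢ r≢e = refl

-- Raising preserves admissibility

-- The paper's R_d with d = suc e: D = row d is the X-row and U = row e the V-row, both of rank t.
module Raising {n T ρ} (adm : AdmissibleWith n T ρ) (e : ℕ) (e<n-1 : suc e ≤ n ∸ 1)
               (x-row : XRow n T (suc e)) (v-row : VRow n T e) where

  open AdmissibleFacts adm

  t : ℕ
  t = ρ (suc e)

  U D : List Sym
  U = row T e
  D = row T (suc e)

  newU newD : List Sym
  newU = map (raiseU U D) (positions (length U))
  newD = map (raiseD t U D) (positions (length D))

  T' : Tri
  T' = raise t (suc e) T

  ρ' : ℕ → ℕ
  ρ' = setRank ρ e (suc t)

  private
    e<n : suc e ≤ n
    e<n = ≤-trans e<n-1 (m∸n≤m n 1)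

    length-D : length D ≡ suc e
    length-D = length-row (suc e) (s≤s z≤n) e<n

    length-U : length U ≡ e
    length-U = length-row₀ e (≤-trans (n≤1+n e) e<n)

    ρe≡t : ρ e ≡ t
    ρe≡t = XRow⇒rank (suc e) (s≤s z≤n) e<n-1 x-row

    U-InV : All (InV n t) U
    U-InV = subst (λ k → All (InV n k) U) ρe≡t (VRow⇒InV e (≤-trans (n≤1+n e) e<n-1) v-row)

    ρ-above : 1 ≤ e → ρ (e ∸ 1) ≡ suc t
    ρ-above 1≤e = trans (proj₂ (VRow⇒rank e 1≤e (≤-trans (n≤1+n e) e<n-1) v-row)) (cong suc ρe≡t)

    t≥1 : 1 ≤ t
    t≥1 = rank≥1 (suc e) (s≤s z≤n) e<n-1

    module _ q (1≤q : 1 ≤ q) (q≤ : q ≤ suc e) where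
      at-D : at D q ≡ just (get D q)
      at-D = at≡get D 1≤q (subst (q ≤_) (sym length-D) q≤)

      D-nat : LeftNatural t (get D q)
      D-nat = leftNatural-at (suc e) (s≤s z≤n) e<n q at-D

      D-entry : XEntry t (get D q)
      D-entry = XEntry-of (All-at D x-row q at-D) D-nat

    module _ p (1≤p : 1 ≤ p) (p≤ : p ≤ e) where
      at-U : at U p ≡ just (get U p)
      at-U = at≡get U 1≤p (subst (p ≤_) (sym length-U) p≤)

      U-entry : InV n t (get U p)
      U-entry = All-at U U-InV p at-U

    U-spans : ∀ q → Spans t (get U q)
    U-spans = All-get U (All.map InV⇒Spans U-InV) tt

    old-middle : ∀ p → 1 ≤ p → p ≤ e → ArrCondℕ t t (get D p) (get U p) (get D (suc p))
    old-middle p 1≤p p≤e =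
      ArrCond⇒ArrCondℕ (D-nat p 1≤p (m≤n⇒m≤1+n p≤e)) (InV⇒LeftNatural (U-entry p 1≤p p≤e))
        (D-nat (suc p) (s≤s z≤n) (s≤s p≤e))
        (subst (λ k → ArrCond t k (get D p) (get U p) (get D (suc p))) ρe≡t
          (arranged (suc e) (s≤s (≤-trans 1≤p p≤e)) e<n p 1≤p p≤e
             (at-D p 1≤p (m≤n⇒m≤1+n p≤e)) (at-U p 1≤p p≤e) (at-D (suc p) (s≤s z≤n) (s≤s p≤e))))

  D⁺ U⁺ : ℕ → Sym
  D⁺ q = toV t (get D q) (get U q) (get U (pred q))
  U⁺ p = toX (get U p) (get D p) (get D (suc p))

  private
    at-newD : ∀ {q s} → at newD q ≡ just s → (1 ≤ q × q ≤ suc e) × D⁺ q ≡ s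
    at-newD {q} at≡s with at-map-positions⇒ (raiseD t U D) {length D} {q} at≡s
    ... | (1≤q , q≤) , raised≡s = (1≤q , subst (q ≤_) length-D q≤) , trans (sym (raiseD≡toV t U D q)) raised≡s

    at-newU : ∀ {p s} → at newU p ≡ just s → (1 ≤ p × p ≤ e) × U⁺ p ≡ s
    at-newU {p} at≡s with at-map-positions⇒ (raiseU U D) {length U} {p} at≡s
    ... | (1≤p , p≤) , raised≡s = (1≤p , subst (p ≤_) length-U p≤) , trans (sym (raiseU≡toX U D p)) raised≡s

    D⁺-values : ∀ q → 1 ≤ q → q ≤ suc e →
      left t (D⁺ q) ≡ left t (get D q) × right t (D⁺ q) ≡ right t (get D q) × IsAB (D⁺ q)
    D⁺-values q 1≤q q≤ = toV-values t _ _ _ (D-entry q 1≤q q≤) (U-spans q) (U-spans (pred q))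

    D⁺-InV : ∀ q → 1 ≤ q → q ≤ suc e → InV n t (D⁺ q)
    D⁺-InV q 1≤q q≤ with D⁺-values q 1≤q q≤
    ... | left≡ , right≡ , ab =
      IsAB⇒InV ab t≥1
        (subst (1 ≤_) (sym left≡) (left≥1-at (suc e) (s≤s z≤n) e<n q (at-D q 1≤q q≤)))
        (subst (_≤ n) (sym right≡) (right≤n-at (suc e) (s≤s z≤n) e<n q (at-D q 1≤q q≤)))
        (trans right≡ (trans (InX-interval (All-at D x-row q (at-D q 1≤q q≤)) (D-nat q 1≤q q≤)) (cong (_+ t) (sym left≡))))

    U⁺-endpoint : ∀ p (1≤p : 1 ≤ p) (p≤e : p ≤ e) → Endpoint t (suc (predLeft (VEntry-of (U-entry p 1≤p p≤e)))) (U⁺ p)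
    U⁺-endpoint p 1≤p p≤e = toX-endpoint t _ _ _ (VEntry-of (U-entry p 1≤p p≤e))

    U⁺-InX : ∀ p → 1 ≤ p → p ≤ e → InX n (U⁺ p)
    U⁺-InX p 1≤p p≤e = Endpoint-InX (VEntry-of (U-entry p 1≤p p≤e))
      (subst (λ k → right k (get U p) ≤ n) ρe≡t (right≤n-at e (≤-trans 1≤p p≤e) (≤-trans (n≤1+n e) e<n) p (at-U p 1≤p p≤e)))
      (U⁺-endpoint p 1≤p p≤e)

    U⁺-nat : ∀ p → 1 ≤ p → p ≤ e → LeftNatural (suc t) (U⁺ p)
    U⁺-nat p 1≤p p≤e = Endpoint-LeftNatural (U⁺-endpoint p 1≤p p≤e)

  newD-InV : All (InV n t) newD
  newD-InV = All-map-positions (raiseD t U D) (length D)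
    λ q 1≤q q≤ → subst (InV n t) (sym (raiseD≡toV t U D q)) (D⁺-InV q 1≤q (subst (q ≤_) length-D q≤))

  newU-InX : All (InX n) newU
  newU-InX = All-map-positions (raiseU U D) (length U)
    λ p 1≤p p≤ → subst (InX n) (sym (raiseU≡toX U D p)) (U⁺-InX p 1≤p (subst (p ≤_) length-U p≤))

  row-lower : row T' (suc e) ≡ newD
  row-lower = row-replaceRows-lower e newU newD T (subst (suc e ≤_) (sym length-T) e<n)

  row-upper : row T' e ≡ newU
  row-upper = row-replaceRows-upper e newU newD T (subst (e ≤_) (sym length-T) (≤-trans (n≤1+n e) e<n))
                (trans (length-map-positions _ (length U)) length-U)

  row-other : ∀ {r} → r ≢ e → r ≢ suc e → row T' r ≡ row T r
  row-other = row-replaceRows-other e newU newD T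

  ρ'-other : ∀ {r} → r ≢ e → ρ' r ≡ ρ r
  ρ'-other = setRank-≢ ρ e (suc t)

  ρ'-lower : ρ' (suc e) ≡ t
  ρ'-lower = ρ'-other (λ ())

  ρ'-upper : ρ' e ≡ suc t
  ρ'-upper = setRank-≡ ρ e (suc t)

  private
    arranged-below : ArrangedRows (ρ (suc (suc e))) t (suc e) (row T (suc (suc e))) newD
    arranged-below p 1≤p p≤1+e at-u at-v at-w with at-newD {p} at-v
    ... | _ , refl with D⁺-values p 1≤p p≤1+e
    ... | left≡ , right≡ , ab =
      ArrCond-sameMiddle (D-nat p 1≤p p≤1+e) (IsAB⇒LeftNatural ab) (sym left≡) (sym right≡)
        (arranged (suc (suc e)) (s≤s (s≤s z≤n)) (≤∸1⇒< (s≤s z≤n) e<n-1) p 1≤p p≤1+e at-u (at-D p 1≤p p≤1+e) at-w)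

    arranged-middle : ArrangedRows t (suc t) e newD newU
    arranged-middle p 1≤p p≤e at-u at-v at-w
      with at-newD {p} at-u | at-newU {p} at-v | at-newD {suc p} at-w
    ... | _ , refl | _ , refl | _ , refl =
      ArrCondℕ⇒ArrCond (IsAB⇒LeftNatural ab₀) (U⁺-nat p 1≤p p≤e) (IsAB⇒LeftNatural ab₁)
        (subst (_≤ left (suc t) (U⁺ p)) (sym left₀) (proj₁ bounds) ,
         subst (right (suc t) (U⁺ p) ≤_) (sym right₁) (proj₂ bounds) ,
         (λ u-y → ⊥-elim (IsAB⇒¬IsY ab₀ u-y)) ,
         (λ w-x → ⊥-elim (IsAB⇒¬IsX ab₁ w-x)) ,
         subst₂ _<_ (sym left₀) (sym left₁) (proj₂ (proj₂ (proj₂ (proj₂ old)))))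
      where
        p≤1+e = m≤n⇒m≤1+n p≤e
        old = old-middle p 1≤p p≤e
        left₀ = proj₁ (D⁺-values p 1≤p p≤1+e)
        ab₀ = proj₂ (proj₂ (D⁺-values p 1≤p p≤1+e))
        left₁ = proj₁ (D⁺-values (suc p) (s≤s z≤n) (s≤s p≤e))
        right₁ = proj₁ (proj₂ (D⁺-values (suc p) (s≤s z≤n) (s≤s p≤e)))
        ab₁ = proj₂ (proj₂ (D⁺-values (suc p) (s≤s z≤n) (s≤s p≤e)))
        bounds = raised-middle-bounds t _ _ _ (D-entry p 1≤p p≤1+e) (D-entry (suc p) (s≤s z≤n) (s≤s p≤e))
                   (VEntry-of (U-entry p 1≤p p≤e)) old

    arranged-above : ArrangedRows (suc t) (suc t) (e ∸ 1) newU (row T (e ∸ 1))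
    arranged-above p {v = v} 1≤p p≤e-1 at-u at-v at-w
      with at-newU {p} at-u | at-newU {suc p} at-w
    ... | _ , refl | _ , refl =
      ArrCondℕ⇒ArrCond (U⁺-nat p 1≤p p≤e) v-nat (U⁺-nat (suc p) (s≤s z≤n) 1+p≤e)
        (raised-upper-arranged t _ _ _ _ _ v (VEntry-of (U-entry p 1≤p p≤e)) (VEntry-of (U-entry (suc p) (s≤s z≤n) 1+p≤e))
           (D-entry (suc p) (s≤s z≤n) (m≤n⇒m≤1+n 1+p≤e))
           old-above (old-middle p 1≤p p≤e) (old-middle (suc p) (s≤s z≤n) 1+p≤e))
      where
        1+p≤e : suc p ≤ e
        1+p≤e = ≤∸1⇒< 1≤p p≤e-1
        p≤e = <⇒≤ 1+p≤e
        1≤e = ≤-trans 1≤p p≤e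
        v-nat : LeftNatural (suc t) v
        v-nat = subst (λ k → LeftNatural k v) (ρ-above 1≤e)
                  (leftNatural-at (e ∸ 1) (≤-trans 1≤p p≤e-1) (≤-trans (m∸n≤m e 1) (≤-trans (n≤1+n e) e<n)) p at-v)
        old-above : ArrCondℕ t (suc t) (get U p) v (get U (suc p))
        old-above =
          ArrCond⇒ArrCondℕ (InV⇒LeftNatural (U-entry p 1≤p p≤e)) v-nat (InV⇒LeftNatural (U-entry (suc p) (s≤s z≤n) 1+p≤e))
            (subst₂ (λ k k' → ArrCond k k' (get U p) v (get U (suc p))) ρe≡t (ρ-above 1≤e)
              (arranged e (≤-trans (s≤s 1≤p) 1+p≤e) (≤-trans (n≤1+n e) e<n) p 1≤p p≤e-1
                 (at-U p 1≤p p≤e) at-v (at-U (suc p) (s≤s z≤n) 1+p≤e)))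

  lower-VRow : All (InV n t) (row T' (suc e))
  lower-VRow = subst (All (InV n t)) (sym row-lower) newD-InV

  upper-XRow : XRow n T' e
  upper-XRow = subst (All (InX n)) (sym row-upper) newU-InX

  private
    ρ'-above : 1 ≤ e → ρ' (e ∸ 1) ≡ suc t
    ρ'-above 1≤e = trans (ρ'-other (∸1≢ 1≤e)) (ρ-above 1≤e)

    row-above : 1 ≤ e → row T' (e ∸ 1) ≡ row T (e ∸ 1)
    row-above 1≤e = row-other (∸1≢ 1≤e) (<⇒≢ (s≤s (m∸n≤m e 1)))

    row-below : row T' (suc (suc e)) ≡ row T (suc (suc e))
    row-below = row-other {suc (suc e)} (λ ()) (λ ())

    arranged-above' : Arranged T' ρ' e
    arranged-above' p 1≤p p≤e-1 =
      ArrangedRows-cong (sym ρ'-upper) (sym (ρ'-above 1≤e)) (sym row-upper) (sym (row-above 1≤e)) arranged-above p 1≤p p≤e-1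
      where 1≤e = ≤-trans 1≤p (≤-trans p≤e-1 (m∸n≤m e 1))

  admissible : AdmissibleWith n T' ρ'
  admissible =
    admissible-replaceRows adm e<n-1 (λ _ → ρ'-other)
      (trans (length-map-positions _ (length D)) length-D)
      (All.map (λ s-v → inj₂ (t , s-v)) newD-InV)
      (inj₂ (subst (λ k → All (InV n k) (row T' (suc e))) (sym ρ'-lower) lower-VRow , trans ρ'-upper (cong suc (sym ρ'-lower))))
      (λ 1≤e → trans (length-map-positions _ (length U)) length-U , All.map inj₁ newU-InX ,
               inj₁ (upper-XRow , trans (ρ'-above 1≤e) (sym ρ'-upper)))
      (ArrangedRows-cong (sym (ρ'-other {suc (suc e)} (λ ()))) (sym ρ'-lower) (sym row-below) (sym row-lower) arranged-below)
      (ArrangedRows-cong (sym ρ'-lower) (sym ρ'-upper) (sym row-lower) (sym row-upper) arranged-middle)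
      arranged-above'

-- Lowering preserves admissibility

-- The paper's L_d with d = suc e: D = row d is the V-row of rank t and U = row e the X-row.
module Lowering {n T ρ} (adm : AdmissibleWith n T ρ) (e : ℕ) (e<n-1 : suc e ≤ n ∸ 1)
                (v-row : VRow n T (suc e)) (x-row : XRow n T e) where

  open AdmissibleFacts adm

  t : ℕ
  t = ρ (suc e)

  U D : List Sym
  U = row T e
  D = row T (suc e)

  newU newD : List Sym
  newU = map (lowerU t U D) (positions (length U))
  newD = map (lowerD U D) (positions (length D))

  T' : Tri
  T' = lower t (suc e) T

  ρ' : ℕ → ℕ
  ρ' = setRank ρ e t

  private
    e<n : suc e ≤ n
    e<n = ≤-trans e<n-1 (m∸n≤m n 1)

    e≤n : e ≤ n
    e≤n = ≤-trans (n≤1+n e) e<n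

    length-D : length D ≡ suc e
    length-D = length-row (suc e) (s≤s z≤n) e<n

    length-U : length U ≡ e
    length-U = length-row₀ e e≤n

    D-InV : All (InV n t) D
    D-InV = proj₁ (VRow⇒rank (suc e) (s≤s z≤n) e<n-1 v-row)

    ρe≡1+t : ρ e ≡ suc t
    ρe≡1+t = proj₂ (VRow⇒rank (suc e) (s≤s z≤n) e<n-1 v-row)

    ρ-above : 1 ≤ e → ρ (e ∸ 1) ≡ suc t
    ρ-above 1≤e = trans (XRow⇒rank e 1≤e (≤-trans (n≤1+n e) e<n-1) x-row) ρe≡1+t

    t≥1 : 1 ≤ t
    t≥1 = rank≥1 (suc e) (s≤s z≤n) e<n-1

    D-spans : ∀ q → Spans t (get D q)
    D-spans = All-get D (All.map InV⇒Spans D-InV) tt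

    module _ q (1≤q : 1 ≤ q) (q≤ : q ≤ suc e) where
      at-D : at D q ≡ just (get D q)
      at-D = at≡get D 1≤q (subst (q ≤_) (sym length-D) q≤)

      D-entry : InV n t (get D q)
      D-entry = All-at D D-InV q at-D

    module _ p (1≤p : 1 ≤ p) (p≤ : p ≤ e) where
      at-U : at U p ≡ just (get U p)
      at-U = at≡get U 1≤p (subst (p ≤_) (sym length-U) p≤)

      U-nat : LeftNatural (suc t) (get U p)
      U-nat = subst (λ k → LeftNatural k (get U p)) ρe≡1+t (leftNatural-at e (≤-trans 1≤p p≤) e≤n p at-U)

      U-entry : XEntry (suc t) (get U p)
      U-entry = XEntry-of (All-at U x-row p at-U) U-nat

    old-middle : ∀ p → 1 ≤ p → p ≤ e → ArrCondℕ t (suc t) (get D p) (get U p) (get D (suc p))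
    old-middle p 1≤p p≤e =
      ArrCond⇒ArrCondℕ (InV⇒LeftNatural (D-entry p 1≤p (m≤n⇒m≤1+n p≤e))) (U-nat p 1≤p p≤e)
        (InV⇒LeftNatural (D-entry (suc p) (s≤s z≤n) (s≤s p≤e)))
        (subst (λ k → ArrCond t k (get D p) (get U p) (get D (suc p))) ρe≡1+t
          (arranged (suc e) (s≤s (≤-trans 1≤p p≤e)) e<n p 1≤p p≤e
             (at-D p 1≤p (m≤n⇒m≤1+n p≤e)) (at-U p 1≤p p≤e) (at-D (suc p) (s≤s z≤n) (s≤s p≤e))))

    module _ p (1≤p : 1 ≤ p) (p≤e-1 : p ≤ e ∸ 1) where
      private
        1+p≤e : suc p ≤ e
        1+p≤e = ≤∸1⇒< 1≤p p≤e-1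
        p≤e : p ≤ e
        p≤e = <⇒≤ 1+p≤e
        1≤e : 1 ≤ e
        1≤e = ≤-trans 1≤p p≤e

      at-F : at (row T (e ∸ 1)) p ≡ just (get (row T (e ∸ 1)) p)
      at-F = at≡get (row T (e ∸ 1)) 1≤p (subst (p ≤_) (sym (length-row₀ (e ∸ 1) (≤-trans (m∸n≤m e 1) e≤n))) p≤e-1)

      F-interval : right (suc t) (get (row T (e ∸ 1)) p) ≡ left (suc t) (get (row T (e ∸ 1)) p) + suc t
      F-interval = subst (λ k → right k (get (row T (e ∸ 1)) p) ≡ left k (get (row T (e ∸ 1)) p) + k) (ρ-above 1≤e)
                     (interval-at (e ∸ 1) (≤-trans 1≤p p≤e-1) (≤-trans (m∸n≤m e 1) (≤-trans (n≤1+n e) e<n-1)) p at-F)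

      F-nat : LeftNatural (suc t) (get (row T (e ∸ 1)) p)
      F-nat = subst (λ k → LeftNatural k (get (row T (e ∸ 1)) p)) (ρ-above 1≤e)
                (leftNatural-at (e ∸ 1) (≤-trans 1≤p p≤e-1) (≤-trans (m∸n≤m e 1) e≤n) p at-F)

      old-above : ArrCondℕ (suc t) (suc t) (get U p) (get (row T (e ∸ 1)) p) (get U (suc p))
      old-above =
        ArrCond⇒ArrCondℕ (U-nat p 1≤p p≤e) F-nat (U-nat (suc p) (s≤s z≤n) 1+p≤e)
          (subst₂ (λ k k' → ArrCond k k' (get U p) (get (row T (e ∸ 1)) p) (get U (suc p))) ρe≡1+t (ρ-above 1≤e)
            (arranged e (≤-trans (s≤s 1≤p) 1+p≤e) e≤n p 1≤p p≤e-1 (at-U p 1≤p p≤e) at-F (at-U (suc p) (s≤s z≤n) 1+p≤e)))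

    U-gap : ∀ q → YXGap (suc t) (get U q) (get U (suc q))
    U-gap q L i U-y U-x =
      y-x-gap (suc t) L i (get (row T (e ∸ 1)) q) (F-interval q 1≤q q≤e-1)
        (subst₂ (λ u w → ArrCondℕ (suc t) (suc t) u (get (row T (e ∸ 1)) q) w) U-y U-x (old-above q 1≤q q≤e-1))
      where
        1≤q = proj₁ (get-bounds U U-y (λ ()))
        q≤e-1 = ∸-monoˡ-≤ 1 (subst (suc q ≤_) length-U (proj₂ (get-bounds U U-x (λ ()))))

  D⁺ U⁺ : ℕ → Sym
  D⁺ q = toX (get D q) (get U q) (get U (pred q))
  U⁺ p = toV t (get U p) (get D p) (get D (suc p))

  private
    at-newD : ∀ {q s} → at newD q ≡ just s → (1 ≤ q × q ≤ suc e) × D⁺ q ≡ s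
    at-newD {q} at≡s with at-map-positions⇒ (lowerD U D) {length D} {q} at≡s
    ... | (1≤q , q≤) , lowered≡s = (1≤q , subst (q ≤_) length-D q≤) , trans (sym (lowerD≡toX U D q)) lowered≡s

    at-newU : ∀ {p s} → at newU p ≡ just s → (1 ≤ p × p ≤ e) × U⁺ p ≡ s
    at-newU {p} at≡s with at-map-positions⇒ (lowerU t U D) {length U} {p} at≡s
    ... | (1≤p , p≤) , lowered≡s = (1≤p , subst (p ≤_) length-U p≤) , trans (sym (lowerU≡toV t U D p)) lowered≡s

    D⁺-values : ∀ q (1≤q : 1 ≤ q) (q≤ : q ≤ suc e) →
      Endpoint t (suc (predLeft (VEntry-of (D-entry q 1≤q q≤)))) (D⁺ q) ×
      left t (D⁺ q) ≡ left t (get D q) × right t (D⁺ q) ≡ right t (get D q)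
    D⁺-values q 1≤q q≤ = toX-values t _ _ _ (VEntry-of (D-entry q 1≤q q≤))

    D⁺-InX : ∀ q → 1 ≤ q → q ≤ suc e → InX n (D⁺ q)
    D⁺-InX q 1≤q q≤ = Endpoint-InX (VEntry-of (D-entry q 1≤q q≤))
      (right≤n-at (suc e) (s≤s z≤n) e<n q (at-D q 1≤q q≤)) (proj₁ (D⁺-values q 1≤q q≤))

    D⁺-nat : ∀ q → 1 ≤ q → q ≤ suc e → LeftNatural t (D⁺ q)
    D⁺-nat q 1≤q q≤ = LeftNatural-weaken (D⁺ q) (Endpoint-LeftNatural (proj₁ (D⁺-values q 1≤q q≤)))

    U⁺-values : ∀ p (1≤p : 1 ≤ p) (p≤e : p ≤ e) → LoweredValues t (U-entry p 1≤p p≤e) (U⁺ p) × IsAB (U⁺ p)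
    U⁺-values p 1≤p p≤e = toV-lowered-values t _ _ _ (U-entry p 1≤p p≤e) (D-spans p) (D-spans (suc p))

    U⁺-InV : ∀ p → 1 ≤ p → p ≤ e → InV n t (U⁺ p)
    U⁺-InV p 1≤p p≤e with U⁺-values p 1≤p p≤e
    ... | values , ab =
      IsAB⇒InV ab t≥1
        (LoweredValues-left≥1 (U-entry p 1≤p p≤e) (subst (λ k → 1 ≤ left k (get U p)) ρe≡1+t U-left≥1) values)
        (≤-trans (lowered-right≤ (U-entry p 1≤p p≤e) values) (subst (λ k → right k (get U p) ≤ n) ρe≡1+t U-right≤n))
        (LoweredValues-interval (U-entry p 1≤p p≤e) values)
      where
        U-left≥1 = left≥1-at e (≤-trans 1≤p p≤e) e≤n p (at-U p 1≤p p≤e)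
        U-right≤n = right≤n-at e (≤-trans 1≤p p≤e) e≤n p (at-U p 1≤p p≤e)

  newD-InX : All (InX n) newD
  newD-InX = All-map-positions (lowerD U D) (length D)
    λ q 1≤q q≤ → subst (InX n) (sym (lowerD≡toX U D q)) (D⁺-InX q 1≤q (subst (q ≤_) length-D q≤))

  newU-InV : All (InV n t) newU
  newU-InV = All-map-positions (lowerU t U D) (length U)
    λ p 1≤p p≤ → subst (InV n t) (sym (lowerU≡toV t U D p)) (U⁺-InV p 1≤p (subst (p ≤_) length-U p≤))

  row-lower : row T' (suc e) ≡ newD
  row-lower = row-replaceRows-lower e newU newD T (subst (suc e ≤_) (sym length-T) e<n)

  row-upper : row T' e ≡ newU
  row-upper = row-replaceRows-upper e newU newD T (subst (e ≤_) (sym length-T) e≤n)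
                (trans (length-map-positions _ (length U)) length-U)

  row-other : ∀ {r} → r ≢ e → r ≢ suc e → row T' r ≡ row T r
  row-other = row-replaceRows-other e newU newD T

  ρ'-other : ∀ {r} → r ≢ e → ρ' r ≡ ρ r
  ρ'-other = setRank-≢ ρ e t

  ρ'-lower : ρ' (suc e) ≡ t
  ρ'-lower = ρ'-other (λ ())

  ρ'-upper : ρ' e ≡ t
  ρ'-upper = setRank-≡ ρ e t

  private
    arranged-below : ArrangedRows (ρ (suc (suc e))) t (suc e) (row T (suc (suc e))) newD
    arranged-below p 1≤p p≤1+e at-u at-v at-w with at-newD {p} at-v
    ... | _ , refl with D⁺-values p 1≤p p≤1+e
    ... | _ , left≡ , right≡ =
      ArrCond-sameMiddle (InV⇒LeftNatural (D-entry p 1≤p p≤1+e)) (D⁺-nat p 1≤p p≤1+e) (sym left≡) (sym right≡)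
        (arranged (suc (suc e)) (s≤s (s≤s z≤n)) (≤∸1⇒< (s≤s z≤n) e<n-1) p 1≤p p≤1+e at-u (at-D p 1≤p p≤1+e) at-w)

    arranged-middle : ArrangedRows t t e newD newU
    arranged-middle (suc p) (s≤s z≤n) 1+p≤e at-u at-v at-w
      with at-newD {suc p} at-u | at-newU {suc p} at-v | at-newD {suc (suc p)} at-w
    ... | _ , refl | _ , refl | _ , refl =
      ArrCondℕ⇒ArrCond (D⁺-nat (suc p) (s≤s z≤n) (m≤n⇒m≤1+n 1+p≤e))
        (IsAB⇒LeftNatural (proj₂ (U⁺-values (suc p) (s≤s z≤n) 1+p≤e))) (D⁺-nat (suc (suc p)) (s≤s z≤n) (s≤s 1+p≤e))
        (lowered-middle-arranged t _ _ _ _ _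
           (VEntry-of (D-entry (suc p) (s≤s z≤n) (m≤n⇒m≤1+n 1+p≤e))) (VEntry-of (D-entry (suc (suc p)) (s≤s z≤n) (s≤s 1+p≤e)))
           (U-entry (suc p) (s≤s z≤n) 1+p≤e) (U-gap p) (U-gap (suc p)) (old-middle (suc p) (s≤s z≤n) 1+p≤e))

    arranged-above : ArrangedRows t (suc t) (e ∸ 1) newU (row T (e ∸ 1))
    arranged-above p 1≤p p≤e-1 at-u at-v at-w
      with at-newU {p} at-u | at-newU {suc p} at-w | get≡ (row T (e ∸ 1)) {p} at-v
    ... | _ , refl | _ , refl | refl =
      ArrCondℕ⇒ArrCond (IsAB⇒LeftNatural (proj₂ (U⁺-values p 1≤p p≤e))) (F-nat p 1≤p p≤e-1)
        (IsAB⇒LeftNatural (proj₂ (U⁺-values (suc p) (s≤s z≤n) 1+p≤e)))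
        (lowered-upper-arranged t _ _ (get (row T (e ∸ 1)) p) _ _ _ (U-entry p 1≤p p≤e) (U-entry (suc p) (s≤s z≤n) 1+p≤e)
           (VEntry-of (D-entry p 1≤p (m≤n⇒m≤1+n p≤e))) (VEntry-of (D-entry (suc p) (s≤s z≤n) (m≤n⇒m≤1+n 1+p≤e)))
           (VEntry-of (D-entry (suc (suc p)) (s≤s z≤n) (s≤s 1+p≤e)))
           (F-interval p 1≤p p≤e-1) (old-above p 1≤p p≤e-1))
      where
        1+p≤e = ≤∸1⇒< 1≤p p≤e-1
        p≤e = <⇒≤ 1+p≤e

  lower-XRow : XRow n T' (suc e)
  lower-XRow = subst (All (InX n)) (sym row-lower) newD-InX

  upper-VRow : All (InV n t) (row T' e)
  upper-VRow = subst (All (InV n t)) (sym row-upper) newU-InV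

  private
    ρ'-above : 1 ≤ e → ρ' (e ∸ 1) ≡ suc t
    ρ'-above 1≤e = trans (ρ'-other (∸1≢ 1≤e)) (ρ-above 1≤e)

    row-above : 1 ≤ e → row T' (e ∸ 1) ≡ row T (e ∸ 1)
    row-above 1≤e = row-other (∸1≢ 1≤e) (<⇒≢ (s≤s (m∸n≤m e 1)))

    row-below : row T' (suc (suc e)) ≡ row T (suc (suc e))
    row-below = row-other {suc (suc e)} (λ ()) (λ ())

    arranged-above' : Arranged T' ρ' e
    arranged-above' p 1≤p p≤e-1 =
      ArrangedRows-cong (sym ρ'-upper) (sym (ρ'-above 1≤e)) (sym row-upper) (sym (row-above 1≤e)) arranged-above p 1≤p p≤e-1
      where 1≤e = ≤-trans 1≤p (≤-trans p≤e-1 (m∸n≤m e 1))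

  admissible : AdmissibleWith n T' ρ'
  admissible =
    admissible-replaceRows adm e<n-1 (λ _ → ρ'-other)
      (trans (length-map-positions _ (length D)) length-D)
      (All.map inj₁ newD-InX)
      (inj₁ (lower-XRow , trans ρ'-upper (sym ρ'-lower)))
      (λ 1≤e → trans (length-map-positions _ (length U)) length-U , All.map (λ s-v → inj₂ (t , s-v)) newU-InV ,
               inj₂ (subst (λ k → All (InV n k) (row T' e)) (sym ρ'-upper) upper-VRow ,
                     trans (ρ'-above 1≤e) (cong suc (sym ρ'-upper))))
      (ArrangedRows-cong (sym (ρ'-other {suc (suc e)} (λ ()))) (sym ρ'-lower) (sym row-below) (sym row-lower) arranged-below)
      (ArrangedRows-cong (sym ρ'-lower) (sym ρ'-upper) (sym row-lower) (sym row-upper) arranged-middle)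
      arranged-above'

-- Deterministic steps with the diamond property

module LabelledRewriting {A : Set} (Step : ℕ → A → A → Set) where

  Chain : List ℕ → A → A → Set
  Chain []       α γ = α ≡ γ
  Chain (d ∷ ds) α γ = Σ A λ β → Step d α β × Chain ds β γ

  Chain-++ : ∀ ds es {α β γ} → Chain ds α β → Chain es β γ → Chain (ds ++ es) α γ
  Chain-++ []       es refl                chain₂ = chain₂
  Chain-++ (d ∷ ds) es (β , step , chain₁) chain₂ = β , step , Chain-++ ds es chain₁ chain₂

  Terminal : A → Set
  Terminal α = ∀ d β → ¬ Step d α β

  module _ (deterministic : ∀ {d α β β'} → Step d α β → Step d α β' → β ≡ β')
           (diamond : ∀ {d d' α β β'} → d ≢ d' → Step d α β → Step d' α β' → ∃ λ γ → Step d' β γ × Step d β' γ)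
           where

    Chain-deterministic : ∀ ds {α β β'} → Chain ds α β → Chain ds α β' → β ≡ β'
    Chain-deterministic []       refl refl = refl
    Chain-deterministic (d ∷ ds) (β , step , chain) (β' , step' , chain')
      rewrite deterministic step step' = Chain-deterministic ds chain chain'

    -- Either the chain starts with the same step, or the diamond moves the step past its first one.
    step-toward-terminal : ∀ ds {α ω} → Chain ds α ω → Terminal ω → ∀ {d β} → Step d α β → ∃ λ cs → Chain cs β ω
    step-toward-terminal []       refl ω-terminal step = ⊥-elim (ω-terminal _ _ step)
    step-toward-terminal (d ∷ ds) (β , step , chain) ω-terminal {d'} step' with d ≟ d'
    ... | yes refl rewrite deterministic step step' = ds , chain
    ... | no d≢d' with diamond d≢d' step step'
    ...   | γ , step-β , step-β' with step-toward-terminal ds chain ω-terminal step-β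
    ...     | cs , chain-γ = d ∷ cs , γ , step-β' , chain-γ

    chain-toward-terminal : ∀ es ds {α β ω} → Chain es α β → Chain ds α ω → Terminal ω → ∃ λ cs → Chain cs β ω
    chain-toward-terminal []       ds refl                  chain ω-terminal = ds , chain
    chain-toward-terminal (e ∷ es) ds (β , step , chain-e) chain ω-terminal
      with step-toward-terminal ds chain ω-terminal step
    ... | cs , chain-cs = chain-toward-terminal es cs chain-e chain-cs ω-terminal

    terminal-unique : ∀ es ds {α ω ω'} → Chain es α ω → Terminal ω → Chain ds α ω' → Terminal ω' → ω ≡ ω'
    terminal-unique es ds chain-ω ω-terminal chain-ω' ω'-terminal
      with chain-toward-terminal es ds chain-ω chain-ω' ω'-terminal
    ... | []     , ω≡ω'            = ω≡ω'
    ... | d ∷ cs , (β , step , _) = ⊥-elim (ω-terminal d β step)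

open LabelledRewriting

-- Raising and lowering steps are deterministic and commute

module _ {n : ℕ} where

  RChain⇒Chain : ∀ ds {S S'} → RChain n ds S S' → Chain (RStep n) ds S S'
  RChain⇒Chain []       chain               = chain
  RChain⇒Chain (d ∷ ds) (S₁ , step , chain) = S₁ , step , RChain⇒Chain ds chain

  Chain⇒RChain : ∀ ds {S S'} → Chain (RStep n) ds S S' → RChain n ds S S'
  Chain⇒RChain []       chain               = chain
  Chain⇒RChain (d ∷ ds) (S₁ , step , chain) = S₁ , step , Chain⇒RChain ds chain

  LChain⇒Chain : ∀ ds {S S'} → LChain n ds S S' → Chain (LStep n) ds S S'
  LChain⇒Chain []       chain               = chain
  LChain⇒Chain (d ∷ ds) (S₁ , step , chain) = S₁ , step , LChain⇒Chain ds chain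

  Chain⇒LChain : ∀ ds {S S'} → Chain (LStep n) ds S S' → LChain n ds S S'
  Chain⇒LChain []       chain               = chain
  Chain⇒LChain (d ∷ ds) (S₁ , step , chain) = S₁ , step , Chain⇒LChain ds chain

RStep-deterministic : ∀ {n d S S₁ S₂} → RStep n d S S₁ → RStep n d S S₂ → S₁ ≡ S₂
RStep-deterministic {d = d} {S} (1≤d , d≤ , _ , adm₁ , _ , _ , refl) (_ , _ , _ , adm₂ , _ , _ , refl) =
  cong (λ t → raise t d S) (ranking-unique adm₁ adm₂ d 1≤d d≤)

LStep-deterministic : ∀ {n d S S₁ S₂} → LStep n d S S₁ → LStep n d S S₂ → S₁ ≡ S₂
LStep-deterministic {d = d} {S} (1≤d , d≤ , _ , adm₁ , _ , _ , refl) (_ , _ , _ , adm₂ , _ , _ , refl) =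
  cong (λ t → lower t d S) (ranking-unique adm₁ adm₂ d 1≤d d≤)

raisedUpper loweredLower : RowsUpdate
raisedUpper U D = map (raiseU U D) (positions (length U))
loweredLower U D = map (lowerD U D) (positions (length D))

raisedLower loweredUpper : ℕ → RowsUpdate
raisedLower t U D = map (raiseD t U D) (positions (length D))
loweredUpper t U D = map (lowerU t U D) (positions (length U))

-- Steps at different rows act on disjoint, non-adjacent pairs of rows, because no row of an admissible
-- triangle is both an X-row and a V-row; so they commute, and each preserves the other's applicability.
RStep-diamond : ∀ {n d d' S S₁ S₂} → d ≢ d' → RStep n d S S₁ → RStep n d' S S₂ →
  ∃ λ S₁₂ → RStep n d' S₁ S₁₂ × RStep n d S₂ S₁₂
RStep-diamond {n} {suc e} {suc f} {S} 1+e≢1+f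
  (s≤s z≤n , e< , ρ₁ , adm₁ , x-row₁ , v-row₁ , refl) (s≤s z≤n , f< , ρ₂ , adm₂ , x-row₂ , v-row₂ , refl) =
  raise (R₁.ρ' (suc f)) (suc f) R₁.T' ,
  (s≤s z≤n , f< , R₁.ρ' , R₁.admissible ,
   subst (All (InX n)) (sym (R₁.row-other 1+f≢e (f≢e ∘ suc-injective))) x-row₂ ,
   (proj₁ v-row₂ , subst (All (InV n (proj₁ v-row₂))) (sym (R₁.row-other f≢e f≢1+e)) (proj₂ v-row₂)) , refl) ,
  (s≤s z≤n , e< , R₂.ρ' , R₂.admissible ,
   subst (All (InX n)) (sym (R₂.row-other 1+e≢f (e≢f ∘ suc-injective))) x-row₁ ,
   (proj₁ v-row₁ , subst (All (InV n (proj₁ v-row₁))) (sym (R₂.row-other e≢f e≢1+f)) (proj₂ v-row₁)) , commute)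
  where
    module R₁ = Raising adm₁ e e< x-row₁ v-row₁
    module R₂ = Raising adm₂ f f< x-row₂ v-row₂
    e≢f : e ≢ f
    e≢f = 1+e≢1+f ∘ cong suc
    f≢e : f ≢ e
    f≢e = e≢f ∘ sym
    f≢1+e : f ≢ suc e
    f≢1+e refl = XRow∧VRow⇒⊥ adm₁ (s≤s z≤n) e< x-row₁ v-row₂
    e≢1+f : e ≢ suc f
    e≢1+f refl = XRow∧VRow⇒⊥ adm₂ (s≤s z≤n) f< x-row₂ v-row₁
    1+f≢e : suc f ≢ e
    1+f≢e = e≢1+f ∘ sym
    1+e≢f : suc e ≢ f
    1+e≢f = f≢1+e ∘ sym
    commute : raise (R₁.ρ' (suc f)) (suc f) R₁.T' ≡ raise (R₂.ρ' (suc e)) (suc e) R₂.T'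
    commute =
      begin
        raise (R₁.ρ' (suc f)) (suc f) (raise (ρ₁ (suc e)) (suc e) S)
      ≡⟨ cong (λ t → raise t (suc f) R₁.T') (trans (R₁.ρ'-other 1+f≢e) (ranking-unique adm₁ adm₂ (suc f) (s≤s z≤n) f<)) ⟩
        raise (ρ₂ (suc f)) (suc f) (raise (ρ₁ (suc e)) (suc e) S)
      ≡⟨ updateRows-comm raisedUpper (raisedLower (ρ₂ (suc f))) raisedUpper (raisedLower (ρ₁ (suc e))) f e S f≢e f≢1+e e≢1+f ⟩
        raise (ρ₁ (suc e)) (suc e) (raise (ρ₂ (suc f)) (suc f) S)
      ≡⟨ cong (λ t → raise t (suc e) R₂.T') (trans (ranking-unique adm₁ adm₂ (suc e) (s≤s z≤n) e<) (sym (R₂.ρ'-other 1+e≢f))) ⟩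
        raise (R₂.ρ' (suc e)) (suc e) (raise (ρ₂ (suc f)) (suc f) S)
      ∎
      where open ≡-Reasoning

LStep-diamond : ∀ {n d d' S S₁ S₂} → d ≢ d' → LStep n d S S₁ → LStep n d' S S₂ →
  ∃ λ S₁₂ → LStep n d' S₁ S₁₂ × LStep n d S₂ S₁₂
LStep-diamond {n} {suc e} {suc f} {S} 1+e≢1+f
  (s≤s z≤n , e< , ρ₁ , adm₁ , v-row₁ , x-row₁ , refl) (s≤s z≤n , f< , ρ₂ , adm₂ , v-row₂ , x-row₂ , refl) =
  lower (L₁.ρ' (suc f)) (suc f) L₁.T' ,
  (s≤s z≤n , f< , L₁.ρ' , L₁.admissible ,
   (proj₁ v-row₂ , subst (All (InV n (proj₁ v-row₂))) (sym (L₁.row-other 1+f≢e (f≢e ∘ suc-injective))) (proj₂ v-row₂)) ,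
   subst (All (InX n)) (sym (L₁.row-other f≢e f≢1+e)) x-row₂ , refl) ,
  (s≤s z≤n , e< , L₂.ρ' , L₂.admissible ,
   (proj₁ v-row₁ , subst (All (InV n (proj₁ v-row₁))) (sym (L₂.row-other 1+e≢f (e≢f ∘ suc-injective))) (proj₂ v-row₁)) ,
   subst (All (InX n)) (sym (L₂.row-other e≢f e≢1+f)) x-row₁ , commute)
  where
    module L₁ = Lowering adm₁ e e< v-row₁ x-row₁
    module L₂ = Lowering adm₂ f f< v-row₂ x-row₂
    e≢f : e ≢ f
    e≢f = 1+e≢1+f ∘ cong suc
    f≢e : f ≢ e
    f≢e = e≢f ∘ sym
    f≢1+e : f ≢ suc e
    f≢1+e refl = XRow∧VRow⇒⊥ adm₁ (s≤s z≤n) e< x-row₂ v-row₁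
    e≢1+f : e ≢ suc f
    e≢1+f refl = XRow∧VRow⇒⊥ adm₂ (s≤s z≤n) f< x-row₁ v-row₂
    1+f≢e : suc f ≢ e
    1+f≢e = e≢1+f ∘ sym
    1+e≢f : suc e ≢ f
    1+e≢f = f≢1+e ∘ sym
    commute : lower (L₁.ρ' (suc f)) (suc f) L₁.T' ≡ lower (L₂.ρ' (suc e)) (suc e) L₂.T'
    commute =
      begin
        lower (L₁.ρ' (suc f)) (suc f) (lower (ρ₁ (suc e)) (suc e) S)
      ≡⟨ cong (λ t → lower t (suc f) L₁.T') (trans (L₁.ρ'-other 1+f≢e) (ranking-unique adm₁ adm₂ (suc f) (s≤s z≤n) f<)) ⟩
        lower (ρ₂ (suc f)) (suc f) (lower (ρ₁ (suc e)) (suc e) S)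
      ≡⟨ updateRows-comm (loweredUpper (ρ₂ (suc f))) loweredLower (loweredUpper (ρ₁ (suc e))) loweredLower f e S f≢e f≢1+e e≢1+f ⟩
        lower (ρ₁ (suc e)) (suc e) (lower (ρ₂ (suc f)) (suc f) S)
      ≡⟨ cong (λ t → lower t (suc e) L₂.T') (trans (ranking-unique adm₁ adm₂ (suc e) (s≤s z≤n) e<) (sym (L₂.ρ'-other 1+e≢f))) ⟩
        lower (L₂.ρ' (suc e)) (suc e) (lower (ρ₂ (suc f)) (suc f) S)
      ∎
      where open ≡-Reasoning

-- The schedules Φ and Ψ

-- The X-row j among rows 1, …, k: each block of Φ moves it from k down to 0 by raising, each block of Ψ
-- from 0 up to k by lowering.
Pattern : ℕ → Tri → ℕ → ℕ → Set
Pattern n T j k = ∀ r → 1 ≤ r → r ≤ n ∸ 1 → (r ≢ j → r ≤ k → VRow n T r) × (r ≡ j ⊎ k < r → XRow n T r)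

VRow-cong : ∀ {n} T T' r → row T' r ≡ row T r → VRow n T r → VRow n T' r
VRow-cong T T' r row≡ (k , v-row) = k , subst (All (InV _ k)) (sym row≡) v-row

XRow-cong : ∀ {n} T T' r → row T' r ≡ row T r → XRow n T r → XRow n T' r
XRow-cong T T' r row≡ = subst (All (InX _)) (sym row≡)

module _ {n : ℕ} where

  Pattern-XRow : ∀ {T j k} → Pattern n T j k → j ≤ n ∸ 1 → XRow n T j
  Pattern-XRow {j = zero}  _   _  = []
  Pattern-XRow {j = suc j} pat j≤ = proj₂ (pat (suc j) (s≤s z≤n) j≤) (inj₁ refl)

  Pattern-VRow : ∀ {T j k} r → Pattern n T j k → r ≢ j → r ≤ k → k ≤ n ∸ 1 → VRow n T r
  Pattern-VRow zero    _   _   _   _  = 0 , []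
  Pattern-VRow (suc r) pat r≢j r≤k k≤ = proj₁ (pat (suc r) (s≤s z≤n) (≤-trans r≤k k≤)) r≢j r≤k

  raise-pattern : ∀ {T ρ j k} → AdmissibleWith n T ρ → suc j ≤ k → k ≤ n ∸ 1 → Pattern n T (suc j) k →
    ∃ λ T' → RStep n (suc j) T T' × Admissible n T' × Pattern n T' j k
  raise-pattern {T} {ρ} {j} {k} adm j<k k≤ pat =
    R.T' , (s≤s z≤n , j<n , ρ , adm , x-row , v-row , refl) , (R.ρ' , R.admissible) , pat'
    where
      j<n = ≤-trans j<k k≤
      x-row = Pattern-XRow pat j<n
      v-row = Pattern-VRow j pat (1+n≢n ∘ sym) (<⇒≤ j<k) k≤
      module R = Raising adm j j<n x-row v-row
      pat' : Pattern n R.T' j k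
      pat' r 1≤r r≤ = V , X
        where
          V : r ≢ j → r ≤ k → VRow n R.T' r
          V r≢j r≤k with r ≟ suc j
          ... | yes refl  = R.t , R.lower-VRow
          ... | no r≢1+j = VRow-cong T R.T' r (R.row-other r≢j r≢1+j) (proj₁ (pat r 1≤r r≤) r≢1+j r≤k)
          X : r ≡ j ⊎ k < r → XRow n R.T' r
          X (inj₁ refl) = R.upper-XRow
          X (inj₂ k<r)  = XRow-cong T R.T' r (R.row-other (<⇒≢ (≤-<-trans (<⇒≤ j<k) k<r) ∘ sym) (<⇒≢ (≤-<-trans j<k k<r) ∘ sym))
                            (proj₂ (pat r 1≤r r≤) (inj₂ k<r))

  lower-pattern : ∀ {T ρ j k} → AdmissibleWith n T ρ → suc j ≤ k → k ≤ n ∸ 1 → Pattern n T j k →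
    ∃ λ T' → LStep n (suc j) T T' × Admissible n T' × Pattern n T' (suc j) k
  lower-pattern {T} {ρ} {j} {k} adm j<k k≤ pat =
    L.T' , (s≤s z≤n , j<n , ρ , adm , v-row , x-row , refl) , (L.ρ' , L.admissible) , pat'
    where
      j<n = ≤-trans j<k k≤
      v-row = Pattern-VRow (suc j) pat 1+n≢n j<k k≤
      x-row = Pattern-XRow pat (≤-trans (n≤1+n j) j<n)
      module L = Lowering adm j j<n v-row x-row
      pat' : Pattern n L.T' (suc j) k
      pat' r 1≤r r≤ = V , X
        where
          V : r ≢ suc j → r ≤ k → VRow n L.T' r
          V r≢1+j r≤k with r ≟ j
          ... | yes refl = L.t , L.upper-VRow
          ... | no r≢j   = VRow-cong T L.T' r (L.row-other r≢j r≢1+j) (proj₁ (pat r 1≤r r≤) r≢j r≤k)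
          X : r ≡ suc j ⊎ k < r → XRow n L.T' r
          X (inj₁ refl) = L.lower-XRow
          X (inj₂ k<r)  = XRow-cong T L.T' r (L.row-other (<⇒≢ (≤-<-trans (<⇒≤ j<k) k<r) ∘ sym) (<⇒≢ (≤-<-trans j<k k<r) ∘ sym))
                            (proj₂ (pat r 1≤r r≤) (inj₂ k<r))

  raise-block : ∀ j {k T ρ} → AdmissibleWith n T ρ → j ≤ k → k ≤ n ∸ 1 → Pattern n T j k →
    ∃ λ T' → Chain (RStep n) (map suc (downFrom j)) T T' × Admissible n T' × Pattern n T' 0 k
  raise-block zero    {T = T} {ρ} adm _ _ pat = T , refl , (ρ , adm) , pat
  raise-block (suc j) adm j<k k≤ pat =
    let T₁ , step , (_ , adm₁) , pat₁ = raise-pattern adm j<k k≤ pat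
        T₂ , chain , adm₂ , pat₂ = raise-block j adm₁ (<⇒≤ j<k) k≤ pat₁
    in T₂ , (T₁ , step , chain) , adm₂ , pat₂

  positions-suc : ∀ m → positions (suc m) ≡ positions m ++ suc m ∷ []
  positions-suc m = trans (cong (map suc) (sym (upTo-∷ʳ m))) (map-++ suc (upTo m) (m ∷ []))

  lower-block : ∀ m {k T ρ} → AdmissibleWith n T ρ → m ≤ k → k ≤ n ∸ 1 → Pattern n T 0 k →
    ∃ λ T' → Chain (LStep n) (positions m) T T' × Admissible n T' × Pattern n T' m k
  lower-block zero    {T = T} {ρ} adm _ _ pat = T , refl , (ρ , adm) , pat
  lower-block (suc m) adm m<k k≤ pat =
    let T₁ , chain , (_ , adm₁) , pat₁ = lower-block m adm (<⇒≤ m<k) k≤ pat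
        T₂ , step , adm₂ , pat₂ = lower-pattern adm₁ m<k k≤ pat₁
    in T₂ , subst (λ ds → Chain (LStep n) ds _ T₂) (sym (positions-suc m))
              (Chain-++ (LStep n) (positions m) _ chain (T₂ , step , refl)) ,
       adm₂ , pat₂

  Pattern-0⇒diagonal : ∀ {T m} → Pattern n T 0 m → Pattern n T (suc m) (suc m)
  Pattern-0⇒diagonal {m = m} pat r 1≤r r≤ = V , X
    where
      V : r ≢ suc m → r ≤ suc m → VRow n _ r
      V r≢1+m r≤1+m = proj₁ (pat r 1≤r r≤) (<⇒≢ 1≤r ∘ sym) (s≤s⁻¹ (≤∧≢⇒< r≤1+m r≢1+m))
      X : r ≡ suc m ⊎ suc m < r → XRow n _ r
      X (inj₁ refl)  = proj₂ (pat r 1≤r r≤) (inj₂ ≤-refl)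
      X (inj₂ 1+m<r) = proj₂ (pat r 1≤r r≤) (inj₂ (<⇒≤ 1+m<r))

  Pattern-diagonal⇒0 : ∀ {T m} → Pattern n T (suc m) (suc m) → Pattern n T 0 m
  Pattern-diagonal⇒0 {m = m} pat r 1≤r r≤ = V , X
    where
      V : r ≢ 0 → r ≤ m → VRow n _ r
      V _ r≤m = proj₁ (pat r 1≤r r≤) (<⇒≢ (s≤s r≤m)) (m≤n⇒m≤1+n r≤m)
      X : r ≡ 0 ⊎ m < r → XRow n _ r
      X (inj₁ refl) = ⊥-elim (<⇒≢ 1≤r refl)
      X (inj₂ m<r) with m≤n⇒m<n∨m≡n m<r
      ... | inj₁ 1+m<r = proj₂ (pat r 1≤r r≤) (inj₂ 1+m<r)
      ... | inj₂ 1+m≡r = proj₂ (pat r 1≤r r≤) (inj₁ (sym 1+m≡r))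

  φ-prefix : ℕ → List ℕ
  φ-prefix m = concat (map (λ k → map suc (downFrom k)) (positions m))

  φ-prefix-suc : ∀ m → φ-prefix (suc m) ≡ φ-prefix m ++ map suc (downFrom (suc m))
  φ-prefix-suc m =
    begin
      concat (map block (positions (suc m)))
    ≡⟨ cong (concat ∘ map block) (positions-suc m) ⟩
      concat (map block (positions m ++ suc m ∷ []))
    ≡⟨ cong concat (map-++ block (positions m) (suc m ∷ [])) ⟩
      concat (map block (positions m) ++ block (suc m) ∷ [])
    ≡⟨ sym (concat-++ (map block (positions m)) (block (suc m) ∷ [])) ⟩
      φ-prefix m ++ block (suc m) ++ []
    ≡⟨ cong (φ-prefix m ++_) (++-identityʳ (block (suc m))) ⟩
      φ-prefix m ++ block (suc m)
    ∎
    where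
      open ≡-Reasoning
      block : ℕ → List ℕ
      block k = map suc (downFrom k)

  raise-schedule : ∀ m {T ρ} → AdmissibleWith n T ρ → m ≤ n ∸ 1 → Pattern n T 0 0 →
    ∃ λ T' → Chain (RStep n) (φ-prefix m) T T' × Admissible n T' × Pattern n T' 0 m
  raise-schedule zero    {T} {ρ} adm _ pat = T , refl , (ρ , adm) , pat
  raise-schedule (suc m) adm m< pat =
    let T₁ , chain₁ , (_ , adm₁) , pat₁ = raise-schedule m adm (<⇒≤ m<) pat
        T₂ , chain₂ , adm₂ , pat₂ = raise-block (suc m) adm₁ ≤-refl m< (Pattern-0⇒diagonal pat₁)
    in T₂ , subst (λ ds → Chain (RStep n) ds _ T₂) (sym (φ-prefix-suc m))
              (Chain-++ (RStep n) (φ-prefix m) _ chain₁ chain₂) ,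
       adm₂ , pat₂

  ψ-suffix : ℕ → List ℕ
  ψ-suffix m = concat (map positions (map suc (downFrom m)))

  lower-schedule : ∀ m {T ρ} → AdmissibleWith n T ρ → m ≤ n ∸ 1 → Pattern n T 0 m →
    ∃ λ T' → Chain (LStep n) (ψ-suffix m) T T' × Pattern n T' 0 0
  lower-schedule zero    {T} adm _ pat = T , refl , pat
  lower-schedule (suc m) adm m< pat =
    let T₁ , chain₁ , (_ , adm₁) , pat₁ = lower-block (suc m) adm ≤-refl m< pat
        T₂ , chain₂ , pat₂ = lower-schedule m adm₁ (<⇒≤ m<) (Pattern-diagonal⇒0 pat₁)
    in T₂ , Chain-++ (LStep n) (positions (suc m)) (ψ-suffix m) chain₁ chain₂ , pat₂

  VRows-terminal : ∀ {T} → Pattern n T 0 (n ∸ 1) → Terminal (RStep n) T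
  VRows-terminal pat d _ (1≤d , d≤ , _ , adm , x-row , _) =
    XRow∧VRow⇒⊥ adm 1≤d d≤ x-row (proj₁ (pat d 1≤d d≤) (<⇒≢ 1≤d ∘ sym) d≤)

  XRows-terminal : ∀ {T} → Pattern n T 0 0 → Terminal (LStep n) T
  XRows-terminal pat d _ (1≤d , d≤ , _ , adm , v-row , _) =
    XRow∧VRow⇒⊥ adm 1≤d d≤ (proj₂ (pat d 1≤d d≤) (inj₂ 1≤d)) v-row

-- Oriented monotone triangles and tournaments

IsAB⇒¬InX : ∀ {n s} → IsAB s → ¬ InX n s
IsAB⇒¬InX (_ , _ , inj₁ refl) ()
IsAB⇒¬InX (_ , _ , inj₂ refl) ()

XY⇒¬IsAB : ∀ {s} → IsX s ⊎ IsY s → ¬ IsAB s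
XY⇒¬IsAB (inj₁ (_ , refl)) (_ , _ , inj₁ ())
XY⇒¬IsAB (inj₁ (_ , refl)) (_ , _ , inj₂ ())
XY⇒¬IsAB (inj₂ (_ , refl)) (_ , _ , inj₁ ())
XY⇒¬IsAB (inj₂ (_ , refl)) (_ , _ , inj₂ ())

XY⇒¬InV : ∀ {n k s} → IsX s ⊎ IsY s → ¬ InV n k s
XY⇒¬InV (inj₁ (_ , refl)) ()
XY⇒¬InV (inj₂ (_ , refl)) ()

module _ {n : ℕ} {T : Tri} where

  IsT-first-entry : IsT n T → ∀ r → 1 ≤ r → r ≤ n ∸ 1 → ∃ λ s → at (row T r) 1 ≡ just s × IsAB s
  IsT-first-entry T-T r 1≤r r≤ with proj₂ T-T r 1 1≤r r≤ ≤-refl 1≤r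
  ... | inj₁ at≡a = _ , at≡a , _ , _ , inj₁ refl
  ... | inj₂ at≡b = _ , at≡b , _ , _ , inj₂ refl

  IsO-first-entry : IsO n T → ∀ r → 1 ≤ r → r ≤ n ∸ 1 → ∃ λ s → at (row T r) 1 ≡ just s × (IsX s ⊎ IsY s)
  IsO-first-entry T-O r 1≤r r≤ with at-within (row T r) ≤-refl (subst (1 ≤_) (sym length≡r) 1≤r)
    where length≡r = proj₁ (proj₂ (proj₁ T-O)) r 1≤r (≤-trans r≤ (m∸n≤m n 1))
  ... | s , at≡s = s , at≡s , All-at (row T r) (proj₁ (proj₂ T-O) r 1≤r r≤) 1 at≡s

  IsT-¬XRow : IsT n T → ∀ r → 1 ≤ r → r ≤ n ∸ 1 → ¬ XRow n T r
  IsT-¬XRow T-T r 1≤r r≤ x-row with IsT-first-entry T-T r 1≤r r≤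
  ... | _ , at≡s , ab = IsAB⇒¬InX ab (All-at (row T r) x-row 1 at≡s)

  IsO-¬VRow : IsO n T → ∀ r → 1 ≤ r → r ≤ n ∸ 1 → ¬ VRow n T r
  IsO-¬VRow T-O r 1≤r r≤ (_ , v-row) with IsO-first-entry T-O r 1≤r r≤
  ... | _ , at≡s , xy = XY⇒¬InV xy (All-at (row T r) v-row 1 at≡s)

  IsO∧IsT⇒⊥ : 2 ≤ n → IsO n T → IsT n T → ⊥
  IsO∧IsT⇒⊥ 2≤n T-O T-T with IsO-first-entry T-O 1 ≤-refl (∸-monoˡ-≤ 1 2≤n) | IsT-first-entry T-T 1 ≤-refl (∸-monoˡ-≤ 1 2≤n)
  ... | _ , at≡s , xy | _ , at≡s' , ab with trans (sym at≡s) at≡s'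
  ... | refl = XY⇒¬IsAB xy ab

  IsT-terminal : IsT n T → Terminal (RStep n) T
  IsT-terminal T-T d _ (1≤d , d≤ , _ , _ , x-row , _) = IsT-¬XRow T-T d 1≤d d≤ x-row

  IsO-terminal : IsO n T → Terminal (LStep n) T
  IsO-terminal T-O d _ (1≤d , d≤ , _ , _ , v-row , _) = IsO-¬VRow T-O d 1≤d d≤ v-row

  IsO⇒XRows : ∀ {ρ} → IsO n T → AdmissibleWith n T ρ → Pattern n T 0 0
  IsO⇒XRows T-O adm r 1≤r r≤ = (λ { _ r≤0 → ⊥-elim (<⇒≢ (≤-trans 1≤r r≤0) refl) }) , λ _ → x-row
    where
      x-row : XRow n T r
      x-row with AdmissibleFacts.rankStep adm r 1≤r r≤
      ... | inj₁ (x-row , _) = x-row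
      ... | inj₂ (v-row , _) = ⊥-elim (IsO-¬VRow T-O r 1≤r r≤ (_ , v-row))

  IsT⇒VRows : ∀ {ρ} → IsT n T → AdmissibleWith n T ρ → Pattern n T 0 (n ∸ 1)
  IsT⇒VRows {ρ} T-T adm r 1≤r r≤ =
    (λ _ _ → v-row) , λ { (inj₁ refl) → ⊥-elim (<⇒≢ 1≤r refl) ; (inj₂ n-1<r) → ⊥-elim (<⇒≢ (≤-trans n-1<r r≤) refl) }
    where
      v-row : VRow n T r
      v-row with AdmissibleFacts.rankStep adm r 1≤r r≤
      ... | inj₁ (x-row , _) = ⊥-elim (IsT-¬XRow T-T r 1≤r r≤ x-row)
      ... | inj₂ (v-row , _) = ρ r , v-row

module _ {n : ℕ} where

  RChain-source-admissible : ∀ u {T T'} → RChain n u T T' → T ≢ T' → Admissible n T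
  RChain-source-admissible []      refl                          T≢T' = ⊥-elim (T≢T' refl)
  RChain-source-admissible (_ ∷ _) (_ , (_ , _ , ρ , adm , _) , _) _    = ρ , adm

  LChain-source-admissible : ∀ u {T T'} → LChain n u T T' → T ≢ T' → Admissible n T
  LChain-source-admissible []      refl                          T≢T' = ⊥-elim (T≢T' refl)
  LChain-source-admissible (_ ∷ _) (_ , (_ , _ , ρ , adm , _) , _) _    = ρ , adm

  Φ-unique : 2 ≤ n → ∀ u → (∀ T → IsO n T → Σ Tri (λ T' → RChain n u T T' × IsT n T')) →
    ∀ T T' → IsO n T → RChain n u T T' → RChain n (φseq n) T T'
  Φ-unique 2≤n u valid T T' T-O chain =
    let T'' , chain'' , T''-T = valid T T-O
        T'-T = subst (IsT n) (Chain-deterministic (RStep n) RStep-deterministic RStep-diamond u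
                                (RChain⇒Chain u chain'') (RChain⇒Chain u chain)) T''-T
        _ , adm = RChain-source-admissible u chain (λ { refl → IsO∧IsT⇒⊥ 2≤n T-O T'-T })
        _ , chain-Φ , _ , all-V = raise-schedule (n ∸ 1) adm ≤-refl (IsO⇒XRows T-O adm)
    in subst (RChain n (φseq n) T)
         (terminal-unique (RStep n) RStep-deterministic RStep-diamond (φseq n) u chain-Φ (VRows-terminal all-V)
            (RChain⇒Chain u chain) (IsT-terminal T'-T))
         (Chain⇒RChain (φseq n) chain-Φ)

  Ψ-unique : 2 ≤ n → ∀ u → (∀ T → IsT n T → Σ Tri (λ T' → LChain n u T T' × IsO n T')) →
    ∀ T T' → IsT n T → LChain n u T T' → LChain n (ψseq n) T T'
  Ψ-unique 2≤n u valid T T' T-T chain =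
    let T'' , chain'' , T''-O = valid T T-T
        T'-O = subst (IsO n) (Chain-deterministic (LStep n) LStep-deterministic LStep-diamond u
                                (LChain⇒Chain u chain'') (LChain⇒Chain u chain)) T''-O
        _ , adm = LChain-source-admissible u chain (λ { refl → IsO∧IsT⇒⊥ 2≤n T'-O T-T })
        _ , chain-Ψ , all-X = lower-schedule (n ∸ 1) adm ≤-refl (IsT⇒VRows T-T adm)
    in subst (LChain n (ψseq n) T)
         (terminal-unique (LStep n) LStep-deterministic LStep-diamond (ψseq n) u chain-Ψ (XRows-terminal all-X)
            (LChain⇒Chain u chain) (IsO-terminal T'-O))
         (Chain⇒LChain (ψseq n) chain-Ψ)

-- Neither the length of u nor the range of its entries is needed: applicability alone pins down the result.
proposition7 : (n : ℕ) → 2 ≤ n →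
    ((u : List ℕ) → length u ≡ Npairs n → All (λ d → 1 ≤ d × d ≤ n ∸ 1) u →
      (∀ T → IsO n T → Σ Tri (λ T' → RChain n u T T' × IsT n T')) →
      ∀ T T' → IsO n T → RChain n u T T' → RChain n (φseq n) T T')
    ×
    ((u : List ℕ) → length u ≡ Npairs n → All (λ d → 1 ≤ d × d ≤ n ∸ 1) u →
      (∀ T → IsT n T → Σ Tri (λ T' → LChain n u T T' × IsO n T')) →
      ∀ T T' → IsT n T → LChain n u T T' → LChain n (ψseq n) T T')
proposition7 n 2≤n = (λ u _ _ → Φ-unique 2≤n u) , (λ u _ _ → Ψ-unique 2≤n u)
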